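{- Let $t$ be a PPC_dB term and $V,M$ lists of lists of distinct symbols for which $\mathcal U_{V,M}(t)$ is defined. If $t\to_{dB}t'$, then $\mathcal U_{V,M}(t)\to_{PPC}\mathcal U_{V,M}(t')$.
   Context: **PPC.** Fix a countably infinite set of symbols. Terms: $t::=x\mid\hat x\mid t\,t\mid\lambda_\theta p.s$, where $\theta$ is a list of symbols binding the matchables $\hat x$ ($x\in\theta$) in $p$ and the variables $x$ in $s$. Terms are taken modulo $\alpha$-conversion. Substitutions act capture-avoidingly on variables. A match is a substitution, $\mathtt{fail}$ or $\mathtt{wait}$ (decided if not $\mathtt{wait}$). Data structures are $d::=\hat x\mid d\,t$; matchable forms are $m::=d\mid\lambda_\theta t.t$. $\mu\uplus\mu'$ is $\mathtt{fail}$ if either match is $\mathtt{fail}$; else $\mathtt{wait}$ if either is $\mathtt{wait}$; else $\mathtt{fail}$ if the domains intersect; else the union. Matching $\{p/u\}_\theta$ (first applicable clause): 1. $\{\hat x/u\}_\theta=\{x\mapsto u\}$ if $x\in\theta$; 2. $\{\hat x/\hat x\}_\theta=\{\}$ if $x\notin\theta$; 3. $\{p\,q/t\,u\}_\theta=\{p/t\}_\theta\uplus\{q/u\}_\theta$ if both are matchable forms; 4. $\mathtt{fail}$ if $p,u$ are matchable forms; 5. $\mathtt{wait}$ otherwise. A substitution result whose domain is not $\theta$ becomes $\mathtt{fail}$. $\mathtt{fail}$ applied to any term gives $\lambda_{[x]}\hat x.x$. $\to_{PPC}$ is the contextual closure of $(\lambda_\theta p.s)u\to\{p/u\}_\theta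 s$ when the match is decided. **PPC_dB.** Terms: $t::=\mathsf v_{i,j}\mid\mathsf m_{i,j}\mid t\,t\mid\lambda_np.s$. Free indices: $fv(\mathsf v_{i,j})=\{(i,j)\}$ and $fm(\mathsf m_{i,j})=\{(i,j)\}$ (empty otherwise); both are unions on applications; $fv(\lambda_np.s)=fv(p)\cup(fv(s)-1)$ and $fm(\lambda_np.s)=(fm(p)-1)\cup fm(s)$. Here $S-1$ decrements first components and drops the non-positive ones. - $\uparrow^{\mathsf v}_k\mathsf v_{i,j}=\mathsf v_{i+1,j}$ if $i>k$, else unchanged; matchables unchanged; homomorphic on applications; $\uparrow^{\mathsf v}_k(\lambda_np.s)=\lambda_n\uparrow^{\mathsf v}_kp.\uparrow^{\mathsf v}_{k+1}s$. - $\uparrow^{\mathsf m}_k$ is symmetric, with $\uparrow^{\mathsf m}_k(\lambda_np.s)=\lambda_n\uparrow^{\mathsf m}_{k+1}p.\uparrow^{\mathsf m}_ks$. - $\downarrow^{\mathsf v}_k$ is like $\uparrow^{\mathsf v}_k$ but subtracts $1$. - The default depth is $0$. Substitution at level $i$, $\{\mathsf v_{i,j}\mapsto u_j\}_{j\in J}$: - maps $\mathsf v_{i,k}\mapsto u_k$ ($k\in J$), leaves $\mathsf v_{i',k}$ ($i'\ne i$) and matchables unchanged; - is homomorphic on applications; - maps $\lambda_np.s\mapsto\lambda_n(\{\mathsf v_{i,j}\mapsto\uparrow^{\mathsf m}u_j\}p).(\{\mathsf v_{i+1,j}\mapsto\uparrow^{\mathsf v}u_j\}s)$. Data structures are $d::=\mathsf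 m_{i,j}\mid d\,t$; matchable forms are $m::=d\mid\lambda_nt.t$. Matching $\{p/u\}_n$: $\{\mathsf m_{1,j}/u\}_n=\{\mathsf v_{1,j}\mapsto u\}$; $\{\mathsf m_{i+1,j}/\mathsf m_{i,j}\}_n=\{\}$; then the application, $\mathtt{fail}$ and $\mathtt{wait}$ clauses as in PPC. A result whose domain is not $\{\mathsf v_{1,1},\dots,\mathsf v_{1,n}\}$ becomes $\mathtt{fail}$. $\mathtt{fail}$ applied to any term gives $\lambda_1\mathsf m_{1,1}.\mathsf v_{1,1}$. $\to_{dB}$ is the contextual closure of $(\lambda_np.s)u\to\downarrow^{\mathsf v}(\{p/\uparrow^{\mathsf v}u\}_ns)$ when the match is decided. **Backward translation.** For lists of lists of symbols ($V_{ij}$ is the $j$-th element of the $i$-th list; $\theta++V=[\theta]++V$): - $\mathcal U_{V,M}(\mathsf v_{i,j})=V_{ij}$ and $\mathcal U_{V,M}(\mathsf m_{i,j})=\widehat{M_{ij}}$; - homomorphic on applications; - $\mathcal U_{V,M}(\lambda_np.s)=\lambda_\theta\mathcal U_{V,\theta++M}(p).\mathcal U_{\theta++V,M}(s)$, with $\theta$ a list of $n$ fresh symbols. $\mathcal U_{V,M}(t)$ is defined when $V_{ij}$ exists for each $(i,j)\in fv(t)$ and $M_{ij}$ exists for each $(i,j)\in fm(t)$. -}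

module Defs where

open import Data.Nat using (ℕ; zero; suc; _+_; _∸_; _<ᵇ_; _≡ᵇ_; _⊔_)
open import Data.Bool using (Bool; true; false; if_then_else_; _∧_; not)
open import Data.List using (List; []; _∷_; _++_; map; length; concat; foldr; upTo; zip)
open import Data.Bool.ListAction using (any; all)
open import Data.Maybe using (Maybe; just; nothing)
open import Data.Product using (_×_; _,_; proj₁; proj₂; ∃-syntax)
open import Relation.Binary.PropositionalEquality using (_≡_)

Sym : Set
Sym = ℕ

_∈ᵇ_ : ℕ → List ℕ → Bool
x ∈ᵇ xs = any (λ y → x ≡ᵇ y) xs

maxL : List ℕ → ℕ
maxL = foldr _⊔_ 0

freshList : ℕ → ℕ → List Sym
freshList k n = map (k +_) (upTo n)

sameSet : List ℕ → List ℕ → Bool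
sameSet xs ys = all (λ x → x ∈ᵇ ys) xs ∧ all (λ y → y ∈ᵇ xs) ys

disjoint : List ℕ → List ℕ → Bool
disjoint xs ys = all (λ x → not (x ∈ᵇ ys)) xs

lookupL : {A : Set} → List (ℕ × A) → ℕ → Maybe A
lookupL [] x = nothing
lookupL ((y , a) ∷ σ) x = if x ≡ᵇ y then just a else lookupL σ x

-- 1-based list indexing (indices in the paper start at 1)
nth : {A : Set} → List A → ℕ → Maybe A
nth [] _ = nothing
nth (x ∷ xs) zero = nothing
nth (x ∷ xs) (suc zero) = just x
nth (x ∷ xs) (suc (suc k)) = nth xs (suc k)

lookup2 : List (List Sym) → ℕ → ℕ → Maybe Sym
lookup2 V i j with nth V i
... | just row = nth row j
... | nothing = nothing

data Match (A : Set) : Set where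
  ok   : A → Match A
  fail : Match A
  wait : Match A

unionM : {A : Set} → Match (List (ℕ × A)) → Match (List (ℕ × A)) → Match (List (ℕ × A))
unionM fail _ = fail
unionM (ok σ) fail = fail
unionM wait fail = fail
unionM wait _ = wait
unionM (ok σ) wait = wait
unionM (ok σ) (ok ρ) =
  if disjoint (map proj₁ σ) (map proj₁ ρ) then ok (σ ++ ρ) else fail

data Term : Set where
  var : Sym → Term
  mat : Sym → Term
  app : Term → Term → Term
  lam : List Sym → Term → Term → Term

bnd : Term → ℕ
bnd (var x) = x
bnd (mat x) = x
bnd (app t u) = bnd t ⊔ bnd u
bnd (lam θ p s) = maxL θ ⊔ bnd p ⊔ bnd s

bndσ : List (Sym × Term) → ℕ
bndσ [] = 0
bndσ ((x , t) ∷ σ) = x ⊔ bnd t ⊔ bndσ σ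

bndτ : List (Sym × Sym) → ℕ
bndτ [] = 0
bndτ ((x , y) ∷ τ) = x ⊔ y ⊔ bndτ τ

-- Capture-avoiding simultaneous substitution σ on variables combined with
-- a renaming τ of free matchables.  Bound symbols are always renamed to
-- symbols fresh for everything in sight.
substR : List (Sym × Term) → List (Sym × Sym) → Term → Term
substR σ τ (var x) with lookupL σ x
... | just u = u
... | nothing = var x
substR σ τ (mat x) with lookupL τ x
... | just y = mat y
... | nothing = mat x
substR σ τ (app t u) = app (substR σ τ t) (substR σ τ u)
substR σ τ (lam θ p s) =
  lam θ' (substR σ (zip θ θ' ++ τ) p) (substR (zip θ (map var θ') ++ σ) τ s)
  where
    θ' : List Sym
    θ' = freshList (suc (bndσ σ ⊔ bndτ τ ⊔ bnd (lam θ p s))) (length θ)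

_·_ : List (Sym × Term) → Term → Term
σ · t = substR σ [] t

-- duplicate pattern of a binder list (position of first occurrence)
firstPos : List ℕ → ℕ → ℕ
firstPos [] x = 0
firstPos (y ∷ ys) x = if x ≡ᵇ y then 0 else suc (firstPos ys x)

shape : List ℕ → List ℕ
shape θ = map (firstPos θ) θ

data _≈α_ : Term → Term → Set where
  var : ∀ x → var x ≈α var x
  mat : ∀ x → mat x ≈α mat x
  app : ∀ {t t' u u'} → t ≈α t' → u ≈α u' → app t u ≈α app t' u'
  lam : ∀ {θ θ' p p' s s'} → shape θ ≡ shape θ' →
        let ζ = freshList (suc (bnd (lam θ p s) ⊔ bnd (lam θ' p' s'))) (length θ) in
        substR [] (zip θ ζ) p ≈α substR [] (zip θ' ζ) p' →
        substR (zip θ (map var ζ)) [] s ≈α substR (zip θ' (map var ζ)) [] s' →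
        lam θ p s ≈α lam θ' p' s'

isData : Term → Bool
isData (mat x) = true
isData (app d t) = isData d
isData _ = false

isMF : Term → Bool
isMF (lam _ _ _) = true
isMF t = isData t

sameMatN : Term → Term → Bool
sameMatN (mat x) (mat y) = x ≡ᵇ y
sameMatN _ _ = false

-- clauses 2, 4, 5 (clause 2 is only reached with x ∉ θ)
restN : Term → Term → Match (List (Sym × Term))
restN p u = if sameMatN p u then ok [] else (if isMF p ∧ isMF u then fail else wait)

matchN : List Sym → Term → Term → Match (List (Sym × Term))
matchN θ (mat x) u = if x ∈ᵇ θ then ok ((x , u) ∷ []) else restN (mat x) u
matchN θ (app p q) (app t u) =
  if isMF (app p q) ∧ isMF (app t u)
  then unionM (matchN θ p t) (matchN θ q u)
  else restN (app p q) (app t u)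
matchN θ p u = restN p u

matchPPC : List Sym → Term → Term → Match (List (Sym × Term))
matchPPC θ p u with matchN θ p u
... | ok σ = if sameSet (map proj₁ σ) θ then ok σ else fail
... | fail = fail
... | wait = wait

data _⟶_ : Term → Term → Set where
  β-ok   : ∀ {θ p s u σ} → matchPPC θ p u ≡ ok σ →
           app (lam θ p s) u ⟶ (σ · s)
  β-fail : ∀ {θ p s u} → matchPPC θ p u ≡ fail →
           app (lam θ p s) u ⟶ lam (0 ∷ []) (mat 0) (var 0)
  appL   : ∀ {t t' u} → t ⟶ t' → app t u ⟶ app t' u
  appR   : ∀ {t u u'} → u ⟶ u' → app t u ⟶ app t u'
  lamP   : ∀ {θ p p' s} → p ⟶ p' → lam θ p s ⟶ lam θ p' s
  lamS   : ∀ {θ p s s'} → s ⟶ s' → lam θ p s ⟶ lam θ p s'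

_→PPC_ : Term → Term → Set
t →PPC t' = ∃[ a ] ∃[ b ] (t ≈α a × a ⟶ b × b ≈α t')

-- PPC_dB (indices are 1-based as in the paper)

data DTerm : Set where
  dv   : ℕ → ℕ → DTerm
  dm   : ℕ → ℕ → DTerm
  dapp : DTerm → DTerm → DTerm
  dlam : ℕ → DTerm → DTerm → DTerm

upV : ℕ → DTerm → DTerm
upV k (dv i j) = if k <ᵇ i then dv (suc i) j else dv i j
upV k (dm i j) = dm i j
upV k (dapp t u) = dapp (upV k t) (upV k u)
upV k (dlam n p s) = dlam n (upV k p) (upV (suc k) s)

upM : ℕ → DTerm → DTerm
upM k (dv i j) = dv i j
upM k (dm i j) = if k <ᵇ i then dm (suc i) j else dm i j
upM k (dapp t u) = dapp (upM k t) (upM k u)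
upM k (dlam n p s) = dlam n (upM (suc k) p) (upM k s)

downV : ℕ → DTerm → DTerm
downV k (dv i j) = if k <ᵇ i then dv (i ∸ 1) j else dv i j
downV k (dm i j) = dm i j
downV k (dapp t u) = dapp (downV k t) (downV k u)
downV k (dlam n p s) = dlam n (downV k p) (downV (suc k) s)

mapσ : (DTerm → DTerm) → List (ℕ × DTerm) → List (ℕ × DTerm)
mapσ f = map (λ { (j , u) → (j , f u) })

-- {v_{i,j} ↦ u_j}_{j ∈ J}, the substitution given as the list of pairs (j , u_j)
substD : ℕ → List (ℕ × DTerm) → DTerm → DTerm
substD i σ (dv i' k) with i' ≡ᵇ i | lookupL σ k
... | true | just u = u
... | _    | _      = dv i' k
substD i σ (dm i' k) = dm i' k
substD i σ (dapp t u) = dapp (substD i σ t) (substD i σ u)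
substD i σ (dlam n p s) =
  dlam n (substD i (mapσ (upM 0) σ) p) (substD (suc i) (mapσ (upV 0) σ) s)

isDataD : DTerm → Bool
isDataD (dm i j) = true
isDataD (dapp d t) = isDataD d
isDataD _ = false

isMFD : DTerm → Bool
isMFD (dlam _ _ _) = true
isMFD t = isDataD t

-- clause {m_{i+1,j} / m_{i,j}} = {}
shiftedMat : DTerm → DTerm → Bool
shiftedMat (dm (suc i) j) (dm i' j') = (i ≡ᵇ i') ∧ (j ≡ᵇ j')
shiftedMat _ _ = false

restD : DTerm → DTerm → Match (List (ℕ × DTerm))
restD p u = if shiftedMat p u then ok [] else (if isMFD p ∧ isMFD u then fail else wait)

-- matching; a result (j , u) stands for v_{1,j} ↦ u
matchD : DTerm → DTerm → Match (List (ℕ × DTerm))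
matchD (dm (suc zero) j) u = ok ((j , u) ∷ [])
matchD (dapp p q) (dapp t u) =
  if isMFD (dapp p q) ∧ isMFD (dapp t u)
  then unionM (matchD p t) (matchD q u)
  else restD (dapp p q) (dapp t u)
matchD p u = restD p u

matchDB : ℕ → DTerm → DTerm → Match (List (ℕ × DTerm))
matchDB n p u with matchD p u
... | ok σ = if sameSet (map proj₁ σ) (map suc (upTo n)) then ok σ else fail
... | fail = fail
... | wait = wait

data _⟶dB_ : DTerm → DTerm → Set where
  β-ok   : ∀ {n p s u σ} → matchDB n p (upV 0 u) ≡ ok σ →
           dapp (dlam n p s) u ⟶dB downV 0 (substD 1 σ s)
  β-fail : ∀ {n p s u} → matchDB n p (upV 0 u) ≡ fail →
           dapp (dlam n p s) u ⟶dB downV 0 (dlam 1 (dm 1 1) (dv 1 1))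
  appL   : ∀ {t t' u} → t ⟶dB t' → dapp t u ⟶dB dapp t' u
  appR   : ∀ {t u u'} → u ⟶dB u' → dapp t u ⟶dB dapp t u'
  lamP   : ∀ {n p p' s} → p ⟶dB p' → dlam n p s ⟶dB dlam n p' s
  lamS   : ∀ {n p s s'} → s ⟶dB s' → dlam n p s ⟶dB dlam n p s'

maxSyms : List (List Sym) → List (List Sym) → ℕ
maxSyms V M = maxL (concat V ++ concat M)

U : List (List Sym) → List (List Sym) → DTerm → Maybe Term
U V M (dv i j) with lookup2 V i j
... | just x = just (var x)
... | nothing = nothing
U V M (dm i j) with lookup2 M i j
... | just x = just (mat x)
... | nothing = nothing
U V M (dapp t u) with U V M t | U V M u
... | just a | just b = just (app a b)
... | _ | _ = nothing
U V M (dlam n p s) = lamU (U V (θ ∷ M) p) (U (θ ∷ V) M s)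
  where
    θ : List Sym
    θ = freshList (suc (maxSyms V M)) n
    lamU : Maybe Term → Maybe Term → Maybe Term
    lamU (just a) (just b) = just (lam θ a b)
    lamU _ _ = nothing

-- Read de Bruijn terms against named ones through a forward translation toDB ρv ρm,
-- whose environments give the de Bruijn atom of every free variable and matchable.  For
-- environments canonical for V and M it is a left inverse of U V M; it commutes with
-- capture-avoiding substitution; and on terms whose binder lists are duplicate-free it is
-- injective up to α-conversion.  A step t ⟶dB t′ is simulated by one raw step of U V M t: in a
-- redex, dB matching and PPC matching succeed, fail or wait together, with substitutions that
-- correspond entry by entry (the i-th fresh binder of the pattern standing for v_{1,i+1}), and the
-- translation of the PPC contractum is the dB contractum.  Hence the reduct and U V M t′ have the
-- same image under toDB and are α-equivalent; U V M t′ is defined because dB substitution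
-- preserves well-scopedness.

{-# OPTIONS --safe #-}
module Submission where

open import Defs
open import Data.List using (List; concat)
open import Data.Maybe using (just)
open import Data.Product using (_×_; ∃-syntax)
open import Data.List.Relation.Unary.Unique.Propositional using (Unique)
open import Relation.Binary.PropositionalEquality using (_≡_)

open import Data.Bool using (Bool; true; false; if_then_else_; _∧_; _∨_; not)
open import Data.Bool.ListAction using (all)
open import Data.Empty using (⊥; ⊥-elim)
open import Data.Unit using (⊤; tt)
open import Data.List using ([]; _∷_; _++_; map; length; upTo; applyUpTo; zip)
open import Data.List.Properties using (length-map; length-upTo; ++-identityʳ)
open import Data.List.Membership.Propositional using (_∈_; _∉_)
open import Data.List.Membership.Propositional.Properties using (∈-map⁺; ∈-map⁻; ∈-++⁺ˡ; ∈-++⁺ʳ; ∈-upTo⁺; ∈-concat⁺′)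
open import Data.List.Relation.Unary.All as All using (All; []; _∷_)
open import Data.List.Relation.Unary.All.Properties using (++⁻ˡ)
open import Data.List.Relation.Unary.Any using (here; there)
open import Data.List.Relation.Unary.AllPairs using ([]; _∷_)
open import Data.List.Relation.Binary.Pointwise using (Pointwise; []; _∷_; ++⁺)
import Data.List.Relation.Unary.Unique.Propositional.Properties as Unique
open import Data.Maybe using (Maybe; nothing; maybe′) renaming (map to mapMaybe)
open import Data.Maybe.Properties using (just-injective)
open import Data.Nat using (ℕ; zero; suc; _+_; _∸_; _≤_; _<_; z≤n; s≤s; _≡ᵇ_; _<ᵇ_; _⊔_)
open import Data.Nat.Properties
open import Data.Product using (_,_; proj₁; proj₂; ∃₂)
open import Data.Sum using (inj₁; inj₂)
open import Function using (_∘_; case_of_)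
open import Relation.Nullary using (Reflects; ofʸ; ofⁿ; proof; yes; no)
open import Relation.Nullary.Reflects using (det)
open import Relation.Binary.PropositionalEquality using (refl; sym; trans; cong; cong₂; subst; _≢_; _≗_; module ≡-Reasoning)

≡ᵇ-reflects : ∀ m n → Reflects (m ≡ n) (m ≡ᵇ n)
≡ᵇ-reflects m n = proof (m ≟ n)

∈ᵇ-reflects : ∀ x xs → Reflects (x ∈ xs) (x ∈ᵇ xs)
∈ᵇ-reflects x [] = ofⁿ λ ()
∈ᵇ-reflects x (y ∷ ys) with x ≡ᵇ y | ≡ᵇ-reflects x y | x ∈ᵇ ys | ∈ᵇ-reflects x ys
... | true  | ofʸ refl | _     | _         = ofʸ (here refl)
... | false | ofⁿ x≢y  | true  | ofʸ x∈ys  = ofʸ (there x∈ys)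
... | false | ofⁿ x≢y  | false | ofⁿ x∉ys  = ofⁿ λ { (here x≡y) → x≢y x≡y ; (there x∈ys) → x∉ys x∈ys }

∈⇒∈ᵇ : ∀ {x xs} → x ∈ xs → (x ∈ᵇ xs) ≡ true
∈⇒∈ᵇ {x} {xs} x∈xs = det (∈ᵇ-reflects x xs) (ofʸ x∈xs)

∉⇒∈ᵇ : ∀ {x xs} → x ∉ xs → (x ∈ᵇ xs) ≡ false
∉⇒∈ᵇ {x} {xs} x∉xs = det (∈ᵇ-reflects x xs) (ofⁿ x∉xs)

∈ᵇ⇒∈ : ∀ {x xs} → (x ∈ᵇ xs) ≡ true → x ∈ xs
∈ᵇ⇒∈ {x} {xs} eq with x ∈ᵇ xs | ∈ᵇ-reflects x xs
... | true | ofʸ x∈xs = x∈xs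

all-∈ : ∀ (p : ℕ → Bool) {x xs} → all p xs ≡ true → x ∈ xs → p x ≡ true
all-∈ p {xs = y ∷ ys} all≡ (here refl) with p y
... | true = refl
all-∈ p {xs = y ∷ ys} all≡ (there x∈ys) with p y
... | true = all-∈ p all≡ x∈ys

∧≡true⇒ʳ : ∀ {a b} → (a ∧ b) ≡ true → b ≡ true
∧≡true⇒ʳ {true} eq = eq

all-map : ∀ (p q : ℕ → Bool) (f : ℕ → ℕ) xs → (∀ x → p (f x) ≡ q x) → all p (map f xs) ≡ all q xs
all-map p q f [] _ = refl
all-map p q f (x ∷ xs) p∘f≗q = cong₂ _∧_ (p∘f≗q x) (all-map p q f xs p∘f≗q)

module _ {f : ℕ → ℕ} (f-injective : ∀ {x y} → f x ≡ f y → x ≡ y) where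

  ≡ᵇ-map : ∀ x y → (f x ≡ᵇ f y) ≡ (x ≡ᵇ y)
  ≡ᵇ-map x y with x ≡ᵇ y | ≡ᵇ-reflects x y
  ... | true  | ofʸ refl = det (≡ᵇ-reflects (f x) (f x)) (ofʸ refl)
  ... | false | ofⁿ x≢y  = det (≡ᵇ-reflects (f x) (f y)) (ofⁿ (x≢y ∘ f-injective))

  ∈ᵇ-map : ∀ x ys → (f x ∈ᵇ map f ys) ≡ (x ∈ᵇ ys)
  ∈ᵇ-map x [] = refl
  ∈ᵇ-map x (y ∷ ys) = cong₂ _∨_ (≡ᵇ-map x y) (∈ᵇ-map x ys)

  sameSet-map : ∀ xs ys → sameSet (map f xs) (map f ys) ≡ sameSet xs ys
  sameSet-map xs ys = cong₂ _∧_ (all-map _ _ f xs (λ x → ∈ᵇ-map x ys)) (all-map _ _ f ys (λ y → ∈ᵇ-map y xs))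

  disjoint-map : ∀ xs ys → disjoint (map f xs) (map f ys) ≡ disjoint xs ys
  disjoint-map xs ys = all-map _ _ f xs (λ x → cong not (∈ᵇ-map x ys))

lookupL-∈ : ∀ {A : Set} (σ : List (ℕ × A)) {j} → j ∈ map proj₁ σ → ∃[ w ] lookupL σ j ≡ just w
lookupL-∈ ((k , a) ∷ σ) {j} j∈σ with j ≡ᵇ k | ≡ᵇ-reflects j k | j∈σ
... | true  | _       | _            = a , refl
... | false | ofⁿ j≢k | here j≡k     = ⊥-elim (j≢k j≡k)
... | false | _       | there j∈σ′   = lookupL-∈ σ j∈σ′

nth-map : ∀ {A B : Set} (f : A → B) xs j → nth (map f xs) j ≡ mapMaybe f (nth xs j)
nth-map f [] j = refl
nth-map f (x ∷ xs) zero = refl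
nth-map f (x ∷ xs) (suc zero) = refl
nth-map f (x ∷ xs) (suc (suc j)) = nth-map f xs (suc j)

nth-map-just : ∀ {A B : Set} (f : A → B) xs {j y′} → nth (map f xs) j ≡ just y′ →
               ∃[ y ] nth xs j ≡ just y × y′ ≡ f y
nth-map-just f xs {j} eq with nth xs j in eqxs | trans (sym eq) (nth-map f xs j)
... | just y | refl = y , refl , refl

nth-bounds : ∀ {A : Set} (xs : List A) {j x} → nth xs j ≡ just x → 1 ≤ j × j ≤ length xs
nth-bounds (y ∷ xs) {suc zero} _ = s≤s z≤n , s≤s z≤n
nth-bounds (y ∷ xs) {suc (suc j)} eq = s≤s z≤n , s≤s (proj₂ (nth-bounds xs eq))

nth-defined : ∀ {A : Set} (xs : List A) {j} → 1 ≤ j → j ≤ length xs → ∃[ x ] nth xs j ≡ just x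
nth-defined (y ∷ xs) {suc zero} _ _ = y , refl
nth-defined (y ∷ xs) {suc (suc j)} _ (s≤s j<len) = nth-defined xs (s≤s z≤n) j<len

nth-∈ : ∀ {A : Set} (xs : List A) {j x} → nth xs j ≡ just x → x ∈ xs
nth-∈ (y ∷ xs) {suc zero} refl = here refl
nth-∈ (y ∷ xs) {suc (suc j)} eq = there (nth-∈ xs eq)

nth-applyUpTo : ∀ {A : Set} (f : ℕ → A) n {j y} → nth (applyUpTo f n) j ≡ just y → ∃[ i ] j ≡ suc i × y ≡ f i
nth-applyUpTo f (suc n) {suc zero} refl = 0 , refl , refl
nth-applyUpTo f (suc n) {suc (suc j)} eq with nth-applyUpTo (f ∘ suc) n eq
... | i , refl , y≡f[1+i] = suc i , refl , y≡f[1+i]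

-- 0-based, whereas nth is 1-based.
indexOf : List Sym → Sym → Maybe ℕ
indexOf [] x = nothing
indexOf (y ∷ θ) x = if x ≡ᵇ y then just 0 else mapMaybe suc (indexOf θ x)

indexOf-∉ : ∀ {θ x} → x ∉ θ → indexOf θ x ≡ nothing
indexOf-∉ {[]} x∉θ = refl
indexOf-∉ {y ∷ θ} {x} x∉θ with x ≡ᵇ y | ≡ᵇ-reflects x y
... | true  | ofʸ x≡y = ⊥-elim (x∉θ (here x≡y))
... | false | _       = cong (mapMaybe suc) (indexOf-∉ (x∉θ ∘ there))

nth-indexOf : ∀ θ {x j} → indexOf θ x ≡ just j → nth θ (suc j) ≡ just x
nth-indexOf (y ∷ θ) {x} eq with x ≡ᵇ y | ≡ᵇ-reflects x y | indexOf θ x in eqθ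
nth-indexOf (y ∷ θ) refl | true  | ofʸ refl | _      = refl
nth-indexOf (y ∷ θ) refl | false | _        | just i = nth-indexOf θ eqθ

indexOf-nth : ∀ {θ j x} → Unique θ → nth θ (suc j) ≡ just x → indexOf θ x ≡ just j
indexOf-nth {y ∷ θ} {zero} _ refl rewrite det (≡ᵇ-reflects y y) (ofʸ refl) = refl
indexOf-nth {y ∷ θ} {suc j} {x} (y∉θ ∷ θ!) eq with x ≡ᵇ y | ≡ᵇ-reflects x y
... | true  | ofʸ refl = ⊥-elim (All.lookup y∉θ (nth-∈ θ eq) refl)
... | false | _        = cong (mapMaybe suc) (indexOf-nth θ! eq)

module _ {A : Set} where

  lookupL-zip-indexOf : ∀ θ (ys : List A) τ {x j} → indexOf θ x ≡ just j → length ys ≡ length θ →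
                        ∃[ y ] nth ys (suc j) ≡ just y × lookupL (zip θ ys ++ τ) x ≡ just y
  lookupL-zip-indexOf (z ∷ θ) (y ∷ ys) τ {x} eq len with x ≡ᵇ z | indexOf θ x in eqθ
  lookupL-zip-indexOf (z ∷ θ) (y ∷ ys) τ refl len | true  | _      = y , refl , refl
  lookupL-zip-indexOf (z ∷ θ) (y ∷ ys) τ refl len | false | just i = lookupL-zip-indexOf θ ys τ eqθ (suc-injective len)

  lookupL-zip-nothing : ∀ θ (ys : List A) τ {x} → indexOf θ x ≡ nothing → lookupL (zip θ ys ++ τ) x ≡ lookupL τ x
  lookupL-zip-nothing [] ys τ eq = refl
  lookupL-zip-nothing (z ∷ θ) [] τ eq = refl
  lookupL-zip-nothing (z ∷ θ) (y ∷ ys) τ {x} eq with x ≡ᵇ z | indexOf θ x in eqθ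
  ... | false | nothing = lookupL-zip-nothing θ ys τ eqθ

freshList-length : ∀ k n → length (freshList k n) ≡ n
freshList-length k n = trans (length-map (k +_) (upTo n)) (length-upTo n)

freshList-unique : ∀ k n → Unique (freshList k n)
freshList-unique k n = Unique.map⁺ (+-cancelˡ-≡ k _ _) (Unique.upTo⁺ n)

freshList-fresh : ∀ {k n x} → x < k → x ∉ freshList k n
freshList-fresh {k} x<k x∈ with ∈-map⁻ (k +_) x∈
... | i , _ , refl = <⇒≱ x<k (m≤m+n k i)

nth-freshList : ∀ k n {j x} → nth (freshList k n) j ≡ just x → ∃[ i ] j ≡ suc i × x ≡ k + i
nth-freshList k n eq with nth-map-just (k +_) (upTo n) eq
... | i , eqUp , refl with nth-applyUpTo (λ i → i) n eqUp
...   | _ , j≡1+i , refl = i , j≡1+i , refl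

firstPos-∷-≢ : ∀ {y} ys zs → All (y ≢_) zs → map (firstPos (y ∷ ys)) zs ≡ map suc (map (firstPos ys) zs)
firstPos-∷-≢ ys [] [] = refl
firstPos-∷-≢ {y} ys (z ∷ zs) (y≢z ∷ y≢zs)
  rewrite det (≡ᵇ-reflects z y) (ofⁿ (y≢z ∘ sym)) = cong (_ ∷_) (firstPos-∷-≢ ys zs y≢zs)

shape-∷ : ∀ {y ys} → All (y ≢_) ys → shape (y ∷ ys) ≡ 0 ∷ map suc (shape ys)
shape-∷ {y} {ys} y∉ys rewrite det (≡ᵇ-reflects y y) (ofʸ refl) = cong (0 ∷_) (firstPos-∷-≢ ys ys y∉ys)

shape-unique : ∀ {θ θ′} → Unique θ → Unique θ′ → length θ ≡ length θ′ → shape θ ≡ shape θ′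
shape-unique {[]} {[]} _ _ _ = refl
shape-unique {y ∷ θ} {y′ ∷ θ′} (y∉θ ∷ θ!) (y′∉θ′ ∷ θ′!) len = begin
  shape (y ∷ θ)           ≡⟨ shape-∷ y∉θ ⟩
  0 ∷ map suc (shape θ)   ≡⟨ cong (λ sh → 0 ∷ map suc sh) (shape-unique θ! θ′! (suc-injective len)) ⟩
  0 ∷ map suc (shape θ′)  ≡⟨ sym (shape-∷ y′∉θ′) ⟩
  shape (y′ ∷ θ′)         ∎
  where open ≡-Reasoning

∈-maxL : ∀ {x xs} → x ∈ xs → x ≤ maxL xs
∈-maxL {xs = y ∷ ys} (here refl) = m≤m⊔n y (maxL ys)
∈-maxL {xs = y ∷ ys} (there x∈ys) = ≤-trans (∈-maxL x∈ys) (m≤n⊔m y (maxL ys))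

lookup2-∈ : ∀ V {i j x} → lookup2 V i j ≡ just x → x ∈ concat V
lookup2-∈ V {i} {j} eq with nth V i in eqV
... | just row = ∈-concat⁺′ (nth-∈ row eq) (nth-∈ V eqV)

lookup2-≤-maxSymsˡ : ∀ V M {i j x} → lookup2 V i j ≡ just x → x ≤ maxSyms V M
lookup2-≤-maxSymsˡ V M eq = ∈-maxL (∈-++⁺ˡ (lookup2-∈ V eq))

lookup2-≤-maxSymsʳ : ∀ V M {i j x} → lookup2 M i j ≡ just x → x ≤ maxSyms V M
lookup2-≤-maxSymsʳ V M eq = ∈-maxL (∈-++⁺ʳ (concat V) (lookup2-∈ M eq))

dv-injective : ∀ {i j i′ j′} → dv i j ≡ dv i′ j′ → i ≡ i′ × j ≡ j′
dv-injective refl = refl , refl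

dm-injective : ∀ {i j i′ j′} → dm i j ≡ dm i′ j′ → i ≡ i′ × j ≡ j′
dm-injective refl = refl , refl

dapp-injective : ∀ {a b a′ b′} → dapp a b ≡ dapp a′ b′ → a ≡ a′ × b ≡ b′
dapp-injective refl = refl , refl

dlam-injective : ∀ {n p s n′ p′ s′} → dlam n p s ≡ dlam n′ p′ s′ → n ≡ n′ × p ≡ p′ × s ≡ s′
dlam-injective refl = refl , refl , refl

dlam-cong : ∀ {n n′ p p′ s s′} → n ≡ n′ → p ≡ p′ → s ≡ s′ → dlam n p s ≡ dlam n′ p′ s′
dlam-cong refl refl refl = refl

shiftIdx : ℕ → ℕ → ℕ
shiftIdx k i = if k <ᵇ i then suc i else i

unshiftIdx : ℕ → ℕ → ℕ
unshiftIdx k i = if k <ᵇ i then i ∸ 1 else i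

shiftIdx-> : ∀ {k i} → k < i → shiftIdx k i ≡ suc i
shiftIdx-> {k} {i} k<i rewrite det (<ᵇ-reflects-< k i) (ofʸ k<i) = refl

shiftIdx-≤ : ∀ {k i} → i ≤ k → shiftIdx k i ≡ i
shiftIdx-≤ {k} {i} i≤k rewrite det (<ᵇ-reflects-< k i) (ofⁿ (≤⇒≯ i≤k)) = refl

unshiftIdx-> : ∀ {k i} → k < i → unshiftIdx k i ≡ i ∸ 1
unshiftIdx-> {k} {i} k<i rewrite det (<ᵇ-reflects-< k i) (ofʸ k<i) = refl

unshiftIdx-≤ : ∀ {k i} → i ≤ k → unshiftIdx k i ≡ i
unshiftIdx-≤ {k} {i} i≤k rewrite det (<ᵇ-reflects-< k i) (ofⁿ (≤⇒≯ i≤k)) = refl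

shiftIdx-shiftIdx : ∀ {c d} i → d ≤ c → shiftIdx (suc c) (shiftIdx d i) ≡ shiftIdx d (shiftIdx c i)
shiftIdx-shiftIdx {c} {d} i d≤c with ≤-<-connex i d | ≤-<-connex i c
... | inj₁ i≤d | _ rewrite shiftIdx-≤ i≤d | shiftIdx-≤ (≤-trans i≤d d≤c) | shiftIdx-≤ i≤d
                   | shiftIdx-≤ (m≤n⇒m≤1+n (≤-trans i≤d d≤c)) = refl
... | inj₂ d<i | inj₁ i≤c rewrite shiftIdx-> d<i | shiftIdx-≤ i≤c | shiftIdx-> d<i | shiftIdx-≤ (s≤s i≤c) = refl
... | inj₂ d<i | inj₂ c<i rewrite shiftIdx-> d<i | shiftIdx-> c<i | shiftIdx-> (s≤s c<i)
                               | shiftIdx-> (m<n⇒m<1+n d<i) = refl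

unshiftIdx-shiftIdx : ∀ k i → unshiftIdx k (shiftIdx k i) ≡ i
unshiftIdx-shiftIdx k i with ≤-<-connex i k
... | inj₁ i≤k rewrite shiftIdx-≤ i≤k = unshiftIdx-≤ i≤k
... | inj₂ k<i rewrite shiftIdx-> k<i = unshiftIdx-> (m<n⇒m<1+n k<i)

shiftIdx-injective : ∀ k {i i′} → shiftIdx k i ≡ shiftIdx k i′ → i ≡ i′
shiftIdx-injective k {i} {i′} eq = begin
  i                           ≡⟨ sym (unshiftIdx-shiftIdx k i) ⟩
  unshiftIdx k (shiftIdx k i)  ≡⟨ cong (unshiftIdx k) eq ⟩
  unshiftIdx k (shiftIdx k i′) ≡⟨ unshiftIdx-shiftIdx k i′ ⟩
  i′                          ∎
  where open ≡-Reasoning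

shiftIdx0≢1 : ∀ i → shiftIdx 0 i ≢ 1
shiftIdx0≢1 zero ()
shiftIdx0≢1 (suc i) ()

upV-dv : ∀ k i j → upV k (dv i j) ≡ dv (shiftIdx k i) j
upV-dv k i j with k <ᵇ i
... | true  = refl
... | false = refl

upM-dm : ∀ k i j → upM k (dm i j) ≡ dm (shiftIdx k i) j
upM-dm k i j with k <ᵇ i
... | true  = refl
... | false = refl

downV-dv : ∀ k i j → downV k (dv i j) ≡ dv (unshiftIdx k i) j
downV-dv k i j with k <ᵇ i
... | true  = refl
... | false = refl

upM-upV : ∀ c d a → upM c (upV d a) ≡ upV d (upM c a)
upM-upV c d (dv i j) rewrite upV-dv d i j = refl
upM-upV c d (dm i j) rewrite upM-dm c i j = refl
upM-upV c d (dapp a b) = cong₂ dapp (upM-upV c d a) (upM-upV c d b)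
upM-upV c d (dlam n p s) = cong₂ (dlam n) (upM-upV (suc c) d p) (upM-upV c (suc d) s)

upM-downV : ∀ c d a → upM c (downV d a) ≡ downV d (upM c a)
upM-downV c d (dv i j) rewrite downV-dv d i j = refl
upM-downV c d (dm i j) rewrite upM-dm c i j = refl
upM-downV c d (dapp a b) = cong₂ dapp (upM-downV c d a) (upM-downV c d b)
upM-downV c d (dlam n p s) = cong₂ (dlam n) (upM-downV (suc c) d p) (upM-downV c (suc d) s)

upV-upV : ∀ {c d} a → d ≤ c → upV (suc c) (upV d a) ≡ upV d (upV c a)
upV-upV {c} {d} (dv i j) d≤c
  rewrite upV-dv d i j | upV-dv (suc c) (shiftIdx d i) j | upV-dv c i j | upV-dv d (shiftIdx c i) j
  = cong (λ i → dv i j) (shiftIdx-shiftIdx i d≤c)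
upV-upV (dm i j) d≤c = refl
upV-upV (dapp a b) d≤c = cong₂ dapp (upV-upV a d≤c) (upV-upV b d≤c)
upV-upV (dlam n p s) d≤c = cong₂ (dlam n) (upV-upV p d≤c) (upV-upV s (s≤s d≤c))

upM-upM : ∀ {c d} a → d ≤ c → upM (suc c) (upM d a) ≡ upM d (upM c a)
upM-upM (dv i j) d≤c = refl
upM-upM {c} {d} (dm i j) d≤c
  rewrite upM-dm d i j | upM-dm (suc c) (shiftIdx d i) j | upM-dm c i j | upM-dm d (shiftIdx c i) j
  = cong (λ i → dm i j) (shiftIdx-shiftIdx i d≤c)
upM-upM (dapp a b) d≤c = cong₂ dapp (upM-upM a d≤c) (upM-upM b d≤c)
upM-upM (dlam n p s) d≤c = cong₂ (dlam n) (upM-upM p (s≤s d≤c)) (upM-upM s d≤c)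

downV-upV : ∀ k a → downV k (upV k a) ≡ a
downV-upV k (dv i j) rewrite upV-dv k i j | downV-dv k (shiftIdx k i) j = cong (λ i → dv i j) (unshiftIdx-shiftIdx k i)
downV-upV k (dm i j) = refl
downV-upV k (dapp a b) = cong₂ dapp (downV-upV k a) (downV-upV k b)
downV-upV k (dlam n p s) = cong₂ (dlam n) (downV-upV k p) (downV-upV (suc k) s)

upV-injective : ∀ k {a b} → upV k a ≡ upV k b → a ≡ b
upV-injective k {a} {b} eq = trans (sym (downV-upV k a)) (trans (cong (downV k) eq) (downV-upV k b))

-- From named to de Bruijn terms

Env : Set
Env = Sym → DTerm

bindV : Maybe ℕ → DTerm → DTerm
bindV (just j) _ = dv 1 (suc j)
bindV nothing a = upV 0 a

bindM : Maybe ℕ → DTerm → DTerm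
bindM (just j) _ = dm 1 (suc j)
bindM nothing a = upM 0 a

extendV : List Sym → Env → Env
extendV θ ρ x = bindV (indexOf θ x) (ρ x)

extendM : List Sym → Env → Env
extendM θ ρ x = bindM (indexOf θ x) (ρ x)

toDB : Env → Env → Term → DTerm
toDB ρv ρm (var x) = ρv x
toDB ρv ρm (mat x) = ρm x
toDB ρv ρm (app t u) = dapp (toDB ρv ρm t) (toDB ρv ρm u)
toDB ρv ρm (lam θ p s) = dlam (length θ) (toDB (upM 0 ∘ ρv) (extendM θ ρm) p) (toDB (extendV θ ρv) (upV 0 ∘ ρm) s)

Fresh : List Sym → ℕ → Set
Fresh θ B = ∀ x → x ≤ B → x ∉ θ

Fresh-≤ : ∀ {θ B B′} → Fresh θ B → B′ ≤ B → Fresh θ B′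
Fresh-≤ θ#B B′≤B x x≤B′ = θ#B x (≤-trans x≤B′ B′≤B)

AgreeUpTo : ℕ → Env → Env → Set
AgreeUpTo B ρ ρ′ = ∀ x → x ≤ B → ρ x ≡ ρ′ x

bnd-appˡ : ∀ a b → bnd a ≤ bnd (app a b)
bnd-appˡ a b = m≤m⊔n (bnd a) (bnd b)

bnd-appʳ : ∀ a b → bnd b ≤ bnd (app a b)
bnd-appʳ a b = m≤n⊔m (bnd a) (bnd b)

bnd-lamᵖ : ∀ θ p s → bnd p ≤ bnd (lam θ p s)
bnd-lamᵖ θ p s = ≤-trans (m≤n⊔m (maxL θ) (bnd p)) (m≤m⊔n (maxL θ ⊔ bnd p) (bnd s))

bnd-lamˢ : ∀ θ p s → bnd s ≤ bnd (lam θ p s)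
bnd-lamˢ θ p s = m≤n⊔m (maxL θ ⊔ bnd p) (bnd s)

toDB-cong-≤ : ∀ {B ρv ρm ρv′ ρm′} t → bnd t ≤ B → AgreeUpTo B ρv ρv′ → AgreeUpTo B ρm ρm′ →
              toDB ρv ρm t ≡ toDB ρv′ ρm′ t
toDB-cong-≤ (var x) t≤B ρv≈ ρm≈ = ρv≈ x t≤B
toDB-cong-≤ (mat x) t≤B ρv≈ ρm≈ = ρm≈ x t≤B
toDB-cong-≤ (app a b) t≤B ρv≈ ρm≈ =
  cong₂ dapp (toDB-cong-≤ a (≤-trans (bnd-appˡ a b) t≤B) ρv≈ ρm≈)
             (toDB-cong-≤ b (≤-trans (bnd-appʳ a b) t≤B) ρv≈ ρm≈)
toDB-cong-≤ (lam θ p s) t≤B ρv≈ ρm≈ = cong₂ (dlam (length θ))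
  (toDB-cong-≤ p (≤-trans (bnd-lamᵖ θ p s) t≤B) (λ x x≤B → cong (upM 0) (ρv≈ x x≤B))
                                                 (λ x x≤B → cong (bindM (indexOf θ x)) (ρm≈ x x≤B)))
  (toDB-cong-≤ s (≤-trans (bnd-lamˢ θ p s) t≤B) (λ x x≤B → cong (bindV (indexOf θ x)) (ρv≈ x x≤B))
                                                 (λ x x≤B → cong (upV 0) (ρm≈ x x≤B)))

toDB-cong : ∀ {ρv ρm ρv′ ρm′} t → ρv ≗ ρv′ → ρm ≗ ρm′ → toDB ρv ρm t ≡ toDB ρv′ ρm′ t
toDB-cong t ρv≗ ρm≗ = toDB-cong-≤ t ≤-refl (λ x _ → ρv≗ x) (λ x _ → ρm≗ x)

upM-toDB : ∀ c ρv ρm w → upM c (toDB ρv ρm w) ≡ toDB (upM c ∘ ρv) (upM c ∘ ρm) w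
upM-toDB c ρv ρm (var x) = refl
upM-toDB c ρv ρm (mat x) = refl
upM-toDB c ρv ρm (app a b) = cong₂ dapp (upM-toDB c ρv ρm a) (upM-toDB c ρv ρm b)
upM-toDB c ρv ρm (lam θ p s) = cong₂ (dlam (length θ))
  (trans (upM-toDB (suc c) _ _ p) (toDB-cong p (λ x → upM-upM (ρv x) z≤n) upM-extendM))
  (trans (upM-toDB c _ _ s) (toDB-cong s upM-extendV (λ x → upM-upV c 0 (ρm x))))
  where
  upM-extendM : ∀ x → upM (suc c) (extendM θ ρm x) ≡ extendM θ (upM c ∘ ρm) x
  upM-extendM x with indexOf θ x
  ... | just j  = refl
  ... | nothing = upM-upM (ρm x) z≤n
  upM-extendV : ∀ x → upM c (extendV θ ρv x) ≡ extendV θ (upM c ∘ ρv) x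
  upM-extendV x with indexOf θ x
  ... | just j  = refl
  ... | nothing = upM-upV c 0 (ρv x)

upV-toDB : ∀ c ρv ρm w → upV c (toDB ρv ρm w) ≡ toDB (upV c ∘ ρv) (upV c ∘ ρm) w
upV-toDB c ρv ρm (var x) = refl
upV-toDB c ρv ρm (mat x) = refl
upV-toDB c ρv ρm (app a b) = cong₂ dapp (upV-toDB c ρv ρm a) (upV-toDB c ρv ρm b)
upV-toDB c ρv ρm (lam θ p s) = cong₂ (dlam (length θ))
  (trans (upV-toDB c _ _ p) (toDB-cong p (λ x → sym (upM-upV 0 c (ρv x))) upV-extendM))
  (trans (upV-toDB (suc c) _ _ s) (toDB-cong s upV-extendV (λ x → upV-upV (ρm x) z≤n)))
  where
  upV-extendM : ∀ x → upV c (extendM θ ρm x) ≡ extendM θ (upV c ∘ ρm) x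
  upV-extendM x with indexOf θ x
  ... | just j  = refl
  ... | nothing = sym (upM-upV 0 c (ρm x))
  upV-extendV : ∀ x → upV (suc c) (extendV θ ρv x) ≡ extendV θ (upV c ∘ ρv) x
  upV-extendV x with indexOf θ x
  ... | just j  = refl
  ... | nothing = upV-upV (ρv x) z≤n

toDB-extendM-fresh : ∀ θ ρv ρm w → Fresh θ (bnd w) → toDB (upM 0 ∘ ρv) (extendM θ ρm) w ≡ upM 0 (toDB ρv ρm w)
toDB-extendM-fresh θ ρv ρm w θ#w =
  trans (toDB-cong-≤ w ≤-refl (λ _ _ → refl) extendM≈upM) (sym (upM-toDB 0 ρv ρm w))
  where
  extendM≈upM : AgreeUpTo (bnd w) (extendM θ ρm) (upM 0 ∘ ρm)
  extendM≈upM x x≤w rewrite indexOf-∉ (θ#w x x≤w) = refl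

toDB-extendV-fresh : ∀ θ ρv ρm w → Fresh θ (bnd w) → toDB (extendV θ ρv) (upV 0 ∘ ρm) w ≡ upV 0 (toDB ρv ρm w)
toDB-extendV-fresh θ ρv ρm w θ#w =
  trans (toDB-cong-≤ w ≤-refl extendV≈upV (λ _ _ → refl)) (sym (upV-toDB 0 ρv ρm w))
  where
  extendV≈upV : AgreeUpTo (bnd w) (extendV θ ρv) (upV 0 ∘ ρv)
  extendV≈upV x x≤w rewrite indexOf-∉ (θ#w x x≤w) = refl

-- Translation commutes with substitution

substEnvV : List (Sym × Term) → Env → Env → Env
substEnvV σ ρv ρm x = maybe′ (toDB ρv ρm) (ρv x) (lookupL σ x)

renameEnvM : List (Sym × Sym) → Env → Env
renameEnvM τ ρm x = maybe′ ρm (ρm x) (lookupL τ x)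

lookupL-bndσ : ∀ σ {x w} → lookupL σ x ≡ just w → bnd w ≤ bndσ σ
lookupL-bndσ ((y , t) ∷ σ) {x} eq with x ≡ᵇ y
lookupL-bndσ ((y , t) ∷ σ) refl | true = ≤-trans (m≤n⊔m y (bnd t)) (m≤m⊔n (y ⊔ bnd t) (bndσ σ))
... | false = ≤-trans (lookupL-bndσ σ eq) (m≤n⊔m (y ⊔ bnd t) (bndσ σ))

lookupL-bndτ : ∀ τ {x z} → lookupL τ x ≡ just z → z ≤ bndτ τ
lookupL-bndτ ((y , t) ∷ τ) {x} eq with x ≡ᵇ y
lookupL-bndτ ((y , t) ∷ τ) refl | true = ≤-trans (m≤n⊔m y t) (m≤m⊔n (y ⊔ t) (bndτ τ))
... | false = ≤-trans (lookupL-bndτ τ eq) (m≤n⊔m (y ⊔ t) (bndτ τ))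

renameEnvM-∘ : ∀ (f : DTerm → DTerm) τ ρm x → renameEnvM τ (f ∘ ρm) x ≡ f (renameEnvM τ ρm x)
renameEnvM-∘ f τ ρm x with lookupL τ x
... | just y  = refl
... | nothing = refl

substEnvV-extendM-fresh : ∀ θ σ ρv ρm x → Fresh θ (bndσ σ) →
  substEnvV σ (upM 0 ∘ ρv) (extendM θ ρm) x ≡ upM 0 (substEnvV σ ρv ρm x)
substEnvV-extendM-fresh θ σ ρv ρm x θ#σ with lookupL σ x in eq
... | just w  = toDB-extendM-fresh θ ρv ρm w (Fresh-≤ θ#σ (lookupL-bndσ σ eq))
... | nothing = refl

substEnvV-extendV-fresh : ∀ θ σ ρv ρm x → Fresh θ (bndσ σ) → x ∉ θ →
  substEnvV σ (extendV θ ρv) (upV 0 ∘ ρm) x ≡ upV 0 (substEnvV σ ρv ρm x)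
substEnvV-extendV-fresh θ σ ρv ρm x θ#σ x∉θ with lookupL σ x in eq
... | just w  = toDB-extendV-fresh θ ρv ρm w (Fresh-≤ θ#σ (lookupL-bndσ σ eq))
... | nothing rewrite indexOf-∉ x∉θ = refl

renameEnvM-extendM-fresh : ∀ θ τ ρm x → Fresh θ (bndτ τ) → x ∉ θ →
  renameEnvM τ (extendM θ ρm) x ≡ upM 0 (renameEnvM τ ρm x)
renameEnvM-extendM-fresh θ τ ρm x θ#τ x∉θ with lookupL τ x in eq
... | just y  rewrite indexOf-∉ (θ#τ y (lookupL-bndτ τ eq)) = refl
... | nothing rewrite indexOf-∉ x∉θ = refl

module _ {B : ℕ} (θ θ′ : List Sym) (θ′! : Unique θ′) (len : length θ′ ≡ length θ) (θ′#B : Fresh θ′ B) where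

  extendM-renameEnvM : ∀ {τ ρm ρm′} → Fresh θ′ (bndτ τ) → AgreeUpTo B ρm′ (renameEnvM τ ρm) →
    AgreeUpTo B (extendM θ ρm′) (renameEnvM (zip θ θ′ ++ τ) (extendM θ′ ρm))
  extendM-renameEnvM {τ} {ρm} {ρm′} θ′#τ ρm′≈ x x≤B with indexOf θ x in eqθ
  ... | just j with lookupL-zip-indexOf θ θ′ τ eqθ len
  ...   | y , eqθ′ , eqzip rewrite eqzip | indexOf-nth θ′! eqθ′ = refl
  extendM-renameEnvM {τ} {ρm} {ρm′} θ′#τ ρm′≈ x x≤B | nothing = begin
    upM 0 (ρm′ x)                                     ≡⟨ cong (upM 0) (ρm′≈ x x≤B) ⟩
    upM 0 (renameEnvM τ ρm x)                         ≡⟨ sym (renameEnvM-extendM-fresh θ′ τ ρm x θ′#τ (θ′#B x x≤B)) ⟩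
    renameEnvM τ (extendM θ′ ρm) x                    ≡⟨ cong (maybe′ _ _) (sym (lookupL-zip-nothing θ θ′ τ eqθ)) ⟩
    renameEnvM (zip θ θ′ ++ τ) (extendM θ′ ρm) x      ∎
    where open ≡-Reasoning

  extendV-substEnvV : ∀ {σ ρv ρm ρv′} → Fresh θ′ (bndσ σ) → AgreeUpTo B ρv′ (substEnvV σ ρv ρm) →
    AgreeUpTo B (extendV θ ρv′) (substEnvV (zip θ (map var θ′) ++ σ) (extendV θ′ ρv) (upV 0 ∘ ρm))
  extendV-substEnvV {σ} {ρv} {ρm} {ρv′} θ′#σ ρv′≈ x x≤B with indexOf θ x in eqθ
  ... | just j with lookupL-zip-indexOf θ (map var θ′) σ eqθ (trans (length-map var θ′) len)
  ...   | y′ , eqθ′ , eqzip with nth-map-just var θ′ eqθ′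
  ...     | y , eqy , refl rewrite eqzip | indexOf-nth θ′! eqy = refl
  extendV-substEnvV {σ} {ρv} {ρm} {ρv′} θ′#σ ρv′≈ x x≤B | nothing = begin
    upV 0 (ρv′ x)                                     ≡⟨ cong (upV 0) (ρv′≈ x x≤B) ⟩
    upV 0 (substEnvV σ ρv ρm x)                       ≡⟨ sym (substEnvV-extendV-fresh θ′ σ ρv ρm x θ′#σ (θ′#B x x≤B)) ⟩
    substEnvV σ (extendV θ′ ρv) (upV 0 ∘ ρm) x        ≡⟨ cong (maybe′ _ _) (sym (lookupL-zip-nothing θ (map var θ′) σ eqθ)) ⟩
    substEnvV (zip θ (map var θ′) ++ σ) (extendV θ′ ρv) (upV 0 ∘ ρm) x ∎
    where open ≡-Reasoning

toDB-substR : ∀ t σ τ {ρv ρm ρv′ ρm′} →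
              AgreeUpTo (bnd t) ρv′ (substEnvV σ ρv ρm) → AgreeUpTo (bnd t) ρm′ (renameEnvM τ ρm) →
              toDB ρv ρm (substR σ τ t) ≡ toDB ρv′ ρm′ t
toDB-substR (var x) σ τ ρv′≈ ρm′≈ with lookupL σ x in eq
... | just w  = sym (trans (ρv′≈ x ≤-refl) (cong (maybe′ _ _) eq))
... | nothing = sym (trans (ρv′≈ x ≤-refl) (cong (maybe′ _ _) eq))
toDB-substR (mat x) σ τ ρv′≈ ρm′≈ with lookupL τ x in eq
... | just y  = sym (trans (ρm′≈ x ≤-refl) (cong (maybe′ _ _) eq))
... | nothing = sym (trans (ρm′≈ x ≤-refl) (cong (maybe′ _ _) eq))
toDB-substR (app a b) σ τ ρv′≈ ρm′≈ = cong₂ dapp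
  (toDB-substR a σ τ (λ x x≤ → ρv′≈ x (≤-trans x≤ (bnd-appˡ a b))) (λ x x≤ → ρm′≈ x (≤-trans x≤ (bnd-appˡ a b))))
  (toDB-substR b σ τ (λ x x≤ → ρv′≈ x (≤-trans x≤ (bnd-appʳ a b))) (λ x x≤ → ρm′≈ x (≤-trans x≤ (bnd-appʳ a b))))
toDB-substR (lam θ p s) σ τ {ρv} {ρm} ρv′≈ ρm′≈ = dlam-cong (freshList-length (suc B) (length θ))
  (toDB-substR p σ (zip θ θ′ ++ τ)
    (λ x x≤p → trans (cong (upM 0) (ρv′≈ x (≤-trans x≤p p≤t))) (sym (substEnvV-extendM-fresh θ′ σ ρv ρm x θ′#σ)))
    (λ x x≤p → extendM-renameEnvM θ θ′ θ′! θ′-length θ′#t θ′#τ ρm′≈ x (≤-trans x≤p p≤t)))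
  (toDB-substR s (zip θ (map var θ′) ++ σ) τ
    (λ x x≤s → extendV-substEnvV θ θ′ θ′! θ′-length θ′#t θ′#σ ρv′≈ x (≤-trans x≤s s≤t))
    (λ x x≤s → trans (cong (upV 0) (ρm′≈ x (≤-trans x≤s s≤t))) (sym (renameEnvM-∘ (upV 0) τ ρm x))))
  where
  B : ℕ
  B = bndσ σ ⊔ bndτ τ ⊔ bnd (lam θ p s)
  θ′ : List Sym
  θ′ = freshList (suc B) (length θ)
  θ′! : Unique θ′
  θ′! = freshList-unique (suc B) (length θ)
  θ′-length : length θ′ ≡ length θ
  θ′-length = freshList-length (suc B) (length θ)
  θ′#B : Fresh θ′ B
  θ′#B x x≤B = freshList-fresh (s≤s x≤B)
  θ′#t : Fresh θ′ (bnd (lam θ p s))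
  θ′#t = Fresh-≤ θ′#B (m≤n⊔m (bndσ σ ⊔ bndτ τ) (bnd (lam θ p s)))
  θ′#σ : Fresh θ′ (bndσ σ)
  θ′#σ = Fresh-≤ θ′#B (≤-trans (m≤m⊔n (bndσ σ) (bndτ τ)) (m≤m⊔n (bndσ σ ⊔ bndτ τ) (bnd (lam θ p s))))
  θ′#τ : Fresh θ′ (bndτ τ)
  θ′#τ = Fresh-≤ θ′#B (≤-trans (m≤n⊔m (bndσ σ) (bndτ τ)) (m≤m⊔n (bndσ σ ⊔ bndτ τ) (bnd (lam θ p s))))
  p≤t : bnd p ≤ bnd (lam θ p s)
  p≤t = bnd-lamᵖ θ p s
  s≤t : bnd s ≤ bnd (lam θ p s)
  s≤t = bnd-lamˢ θ p s

-- Injectivity up to α-conversion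

size : Term → ℕ
size (var x) = 1
size (mat x) = 1
size (app a b) = suc (size a + size b)
size (lam θ p s) = suc (size p + size s)

-- toDB forgets the duplication pattern (shape) of a binder list, which ≈α compares.
UniqueBinders : Term → Set
UniqueBinders (var x) = ⊤
UniqueBinders (mat x) = ⊤
UniqueBinders (app a b) = UniqueBinders a × UniqueBinders b
UniqueBinders (lam θ p s) = Unique θ × UniqueBinders p × UniqueBinders s

IsVar : Term → Set
IsVar t = ∃[ y ] t ≡ var y

AllValues : (Term → Set) → List (Sym × Term) → Set
AllValues P σ = ∀ {x w} → lookupL σ x ≡ just w → P w

AllValues-zip-++ : ∀ {P} xs ys {σ} → (∀ {w} → w ∈ ys → P w) → AllValues P σ → AllValues P (zip xs ys ++ σ)
AllValues-zip-++ [] ys P-ys P-σ eq = P-σ eq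
AllValues-zip-++ (z ∷ xs) [] P-ys P-σ eq = P-σ eq
AllValues-zip-++ (z ∷ xs) (y ∷ ys) P-ys P-σ {x} eq with x ≡ᵇ z
AllValues-zip-++ (z ∷ xs) (y ∷ ys) P-ys P-σ refl | true = P-ys (here refl)
... | false = AllValues-zip-++ xs ys (P-ys ∘ there) P-σ eq

AllValues-renaming : ∀ {P} xs ys {σ} → (∀ y → P (var y)) → AllValues P σ → AllValues P (zip xs (map var ys) ++ σ)
AllValues-renaming {P} xs ys P-var =
  AllValues-zip-++ {P} xs (map var ys) λ w∈ → case ∈-map⁻ var w∈ of λ { (y , _ , refl) → P-var y }

AllValues-renaming-[] : ∀ {P} xs ys → (∀ y → P (var y)) → AllValues P (zip xs (map var ys))
AllValues-renaming-[] {P} xs ys P-var =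
  subst (AllValues P) (++-identityʳ (zip xs (map var ys))) (AllValues-renaming {P} xs ys P-var λ ())

size-substR : ∀ t σ τ → AllValues IsVar σ → size (substR σ τ t) ≡ size t
size-substR (var x) σ τ σ-var with lookupL σ x in eq
... | just w with σ-var eq
...   | y , refl = refl
size-substR (var x) σ τ σ-var | nothing = refl
size-substR (mat x) σ τ σ-var with lookupL τ x
... | just y  = refl
... | nothing = refl
size-substR (app a b) σ τ σ-var = cong₂ (λ m n → suc (m + n)) (size-substR a σ τ σ-var) (size-substR b σ τ σ-var)
size-substR (lam θ p s) σ τ σ-var = cong₂ (λ m n → suc (m + n)) (size-substR p σ _ σ-var)
  (size-substR s _ τ (AllValues-renaming {IsVar} θ _ (λ y → y , refl) σ-var))

UniqueBinders-substR : ∀ t σ τ → AllValues UniqueBinders σ → UniqueBinders (substR σ τ t)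
UniqueBinders-substR (var x) σ τ σ-ub with lookupL σ x in eq
... | just w  = σ-ub eq
... | nothing = tt
UniqueBinders-substR (mat x) σ τ σ-ub with lookupL τ x
... | just y  = tt
... | nothing = tt
UniqueBinders-substR (app a b) σ τ σ-ub = UniqueBinders-substR a σ τ σ-ub , UniqueBinders-substR b σ τ σ-ub
UniqueBinders-substR (lam θ p s) σ τ σ-ub = freshList-unique _ _ , UniqueBinders-substR p σ _ σ-ub ,
  UniqueBinders-substR s _ τ (AllValues-renaming {UniqueBinders} θ _ (λ _ → tt) σ-ub)

≈α-refl-≤ : ∀ n t → size t ≤ n → t ≈α t
≈α-refl-≤ (suc n) (var x) _ = var x
≈α-refl-≤ (suc n) (mat x) _ = mat x
≈α-refl-≤ (suc n) (app a b) (s≤s ab≤n) =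
  app (≈α-refl-≤ n a (≤-trans (m≤m+n (size a) (size b)) ab≤n))
      (≈α-refl-≤ n b (≤-trans (m≤n+m (size b) (size a)) ab≤n))
≈α-refl-≤ (suc n) (lam θ p s) (s≤s ps≤n) = lam refl
  (≈α-refl-≤ n _ (≤-trans (≤-reflexive (size-substR p [] _ λ ())) (≤-trans (m≤m+n (size p) (size s)) ps≤n)))
  (≈α-refl-≤ n _ (≤-trans (≤-reflexive (size-substR s _ [] (AllValues-renaming-[] {IsVar} θ _ (λ y → y , refl))))
                          (≤-trans (m≤n+m (size s) (size p)) ps≤n)))

≈α-refl : ∀ t → t ≈α t
≈α-refl t = ≈α-refl-≤ (size t) t ≤-refl

IsDv : DTerm → Set
IsDv (dv _ _) = ⊤
IsDv _ = ⊥

IsDm : DTerm → Set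
IsDm (dm _ _) = ⊤
IsDm _ = ⊥

IsDv∧IsDm⇒⊥ : ∀ {a} → IsDv a → IsDm a → ⊥
IsDv∧IsDm⇒⊥ {dv _ _} _ ()

record VarAtoms (ρ : Env) : Set where
  field
    isDv      : ∀ x → IsDv (ρ x)
    injective : ∀ {x y} → ρ x ≡ ρ y → x ≡ y

record MatAtoms (ρ : Env) : Set where
  field
    isDm      : ∀ x → IsDm (ρ x)
    injective : ∀ {x y} → ρ x ≡ ρ y → x ≡ y

open VarAtoms using (isDv)
open MatAtoms using (isDm)

upM-IsDv : ∀ c {a} → IsDv a → upM c a ≡ a
upM-IsDv c {dv i j} _ = refl

upV-IsDm : ∀ c {a} → IsDm a → upV c a ≡ a
upV-IsDm c {dm i j} _ = refl

upV-IsDv : ∀ k {a} → IsDv a → IsDv (upV k a)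
upV-IsDv k {dv i j} _ rewrite upV-dv k i j = tt

upM-IsDm : ∀ k {a} → IsDm a → IsDm (upM k a)
upM-IsDm k {dm i j} _ rewrite upM-dm k i j = tt

upV0-IsDv≢dv1 : ∀ {a j} → IsDv a → upV 0 a ≢ dv 1 j
upV0-IsDv≢dv1 {dv i j} _ eq = shiftIdx0≢1 i (proj₁ (dv-injective (trans (sym (upV-dv 0 i j)) eq)))

upM0-IsDm≢dm1 : ∀ {a j} → IsDm a → upM 0 a ≢ dm 1 j
upM0-IsDm≢dm1 {dm i j} _ eq = shiftIdx0≢1 i (proj₁ (dm-injective (trans (sym (upM-dm 0 i j)) eq)))

upM-IsDm-injective : ∀ k {a b} → IsDm a → IsDm b → upM k a ≡ upM k b → a ≡ b
upM-IsDm-injective k {dm i j} {dm i′ j′} _ _ eq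
  with dm-injective (trans (sym (upM-dm k i j)) (trans eq (upM-dm k i′ j′)))
... | i≡ , refl = cong (λ i → dm i j) (shiftIdx-injective k i≡)

extendV-VarAtoms : ∀ θ {ρ} → VarAtoms ρ → VarAtoms (extendV θ ρ)
extendV-VarAtoms θ {ρ} ρ-atoms = record { isDv = isDv′ ; injective = injective′ }
  where
  isDv′ : ∀ x → IsDv (extendV θ ρ x)
  isDv′ x with indexOf θ x
  ... | just j  = tt
  ... | nothing = upV-IsDv 0 (isDv ρ-atoms x)
  injective′ : ∀ {x y} → extendV θ ρ x ≡ extendV θ ρ y → x ≡ y
  injective′ {x} {y} eq with indexOf θ x in eqx | indexOf θ y in eqy | eq
  ... | just j  | just .j | refl = just-injective (trans (sym (nth-indexOf θ eqx)) (nth-indexOf θ eqy))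
  ... | just j  | nothing | eq′  = ⊥-elim (upV0-IsDv≢dv1 (isDv ρ-atoms y) (sym eq′))
  ... | nothing | just j  | eq′  = ⊥-elim (upV0-IsDv≢dv1 (isDv ρ-atoms x) eq′)
  ... | nothing | nothing | eq′  = VarAtoms.injective ρ-atoms (upV-injective 0 eq′)

extendM-MatAtoms : ∀ θ {ρ} → MatAtoms ρ → MatAtoms (extendM θ ρ)
extendM-MatAtoms θ {ρ} ρ-atoms = record { isDm = isDm′ ; injective = injective′ }
  where
  isDm′ : ∀ x → IsDm (extendM θ ρ x)
  isDm′ x with indexOf θ x
  ... | just j  = tt
  ... | nothing = upM-IsDm 0 (isDm ρ-atoms x)
  injective′ : ∀ {x y} → extendM θ ρ x ≡ extendM θ ρ y → x ≡ y
  injective′ {x} {y} eq with indexOf θ x in eqx | indexOf θ y in eqy | eq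
  ... | just j  | just .j | refl = just-injective (trans (sym (nth-indexOf θ eqx)) (nth-indexOf θ eqy))
  ... | just j  | nothing | eq′  = ⊥-elim (upM0-IsDm≢dm1 (isDm ρ-atoms y) (sym eq′))
  ... | nothing | just j  | eq′  = ⊥-elim (upM0-IsDm≢dm1 (isDm ρ-atoms x) eq′)
  ... | nothing | nothing | eq′  =
    MatAtoms.injective ρ-atoms (upM-IsDm-injective 0 (isDm ρ-atoms x) (isDm ρ-atoms y) eq′)

toDB-rename-pattern : ∀ {ρv ρm ζ} θ p → VarAtoms ρv → Unique ζ → length ζ ≡ length θ → Fresh ζ (bnd p) →
  toDB ρv (extendM ζ ρm) (substR [] (zip θ ζ) p) ≡ toDB (upM 0 ∘ ρv) (extendM θ ρm) p
toDB-rename-pattern {ρv} {ρm} {ζ} θ p ρv-atoms ζ! len ζ#p =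
  toDB-substR p [] (zip θ ζ) (λ x _ → upM-IsDv 0 (isDv ρv-atoms x)) extendM≈
  where
  extendM≈ : AgreeUpTo (bnd p) (extendM θ ρm) (renameEnvM (zip θ ζ) (extendM ζ ρm))
  extendM≈ x x≤p = trans (extendM-renameEnvM θ ζ ζ! len ζ#p {τ = []} (Fresh-≤ ζ#p z≤n) (λ _ _ → refl) x x≤p)
                         (cong (λ τ → renameEnvM τ (extendM ζ ρm) x) (++-identityʳ (zip θ ζ)))

toDB-rename-body : ∀ {ρv ρm ζ} θ s → MatAtoms ρm → Unique ζ → length ζ ≡ length θ → Fresh ζ (bnd s) →
  toDB (extendV ζ ρv) ρm (substR (zip θ (map var ζ)) [] s) ≡ toDB (extendV θ ρv) (upV 0 ∘ ρm) s
toDB-rename-body {ρv} {ρm} {ζ} θ s ρm-atoms ζ! len ζ#s =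
  trans (toDB-cong (substR (zip θ (map var ζ)) [] s) (λ _ → refl) (λ x → sym (upV-IsDm 0 (isDm ρm-atoms x))))
        (toDB-substR s (zip θ (map var ζ)) [] extendV≈ (λ _ _ → refl))
  where
  extendV≈ : AgreeUpTo (bnd s) (extendV θ ρv) (substEnvV (zip θ (map var ζ)) (extendV ζ ρv) (upV 0 ∘ ρm))
  extendV≈ x x≤s = trans (extendV-substEnvV θ ζ ζ! len ζ#s {σ = []} {ρm = ρm} (Fresh-≤ ζ#s z≤n) (λ _ _ → refl) x x≤s)
                         (cong (λ σ → substEnvV σ (extendV ζ ρv) (upV 0 ∘ ρm) x) (++-identityʳ (zip θ (map var ζ))))

-- Induction on size: ≈α relates renamed bodies, which are not subterms.
toDB-injective-≤ : ∀ n a b {ρv ρm} → size a ≤ n → VarAtoms ρv → MatAtoms ρm →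
  UniqueBinders a → UniqueBinders b → toDB ρv ρm a ≡ toDB ρv ρm b → a ≈α b
toDB-injective-≤ (suc n) (var x) (var y) _ ρv-atoms _ _ _ h with VarAtoms.injective ρv-atoms h
... | refl = var x
toDB-injective-≤ (suc n) (mat x) (mat y) _ _ ρm-atoms _ _ h with MatAtoms.injective ρm-atoms h
... | refl = mat x
toDB-injective-≤ (suc n) (app a b) (app a′ b′) (s≤s ab≤n) ρv-atoms ρm-atoms (a! , b!) (a′! , b′!) h =
  app (toDB-injective-≤ n a a′ (≤-trans (m≤m+n (size a) (size b)) ab≤n) ρv-atoms ρm-atoms a! a′! (proj₁ (dapp-injective h)))
      (toDB-injective-≤ n b b′ (≤-trans (m≤n+m (size b) (size a)) ab≤n) ρv-atoms ρm-atoms b! b′! (proj₂ (dapp-injective h)))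
toDB-injective-≤ (suc n) (lam θ p s) (lam θ′ p′ s′) (s≤s ps≤n) ρv-atoms ρm-atoms (θ! , p! , s!) (θ′! , p′! , s′!) h
  with dlam-injective h
... | len , hp , hs = lam (shape-unique θ! θ′! len)
  (toDB-injective-≤ n _ _ size-p ρv-atoms (extendM-MatAtoms ζ ρm-atoms)
    (UniqueBinders-substR p [] _ λ ()) (UniqueBinders-substR p′ [] _ λ ())
    (trans (toDB-rename-pattern θ p ρv-atoms ζ! ζ-length ζ#p)
    (trans hp (sym (toDB-rename-pattern θ′ p′ ρv-atoms ζ! (trans ζ-length len) ζ#p′)))))
  (toDB-injective-≤ n _ _ size-s (extendV-VarAtoms ζ ρv-atoms) ρm-atoms
    (UniqueBinders-substR s _ [] (AllValues-renaming-[] {UniqueBinders} θ ζ λ _ → tt))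
    (UniqueBinders-substR s′ _ [] (AllValues-renaming-[] {UniqueBinders} θ′ ζ λ _ → tt))
    (trans (toDB-rename-body θ s ρm-atoms ζ! ζ-length ζ#s)
    (trans hs (sym (toDB-rename-body θ′ s′ ρm-atoms ζ! (trans ζ-length len) ζ#s′)))))
  where
  B : ℕ
  B = bnd (lam θ p s) ⊔ bnd (lam θ′ p′ s′)
  ζ : List Sym
  ζ = freshList (suc B) (length θ)
  ζ! : Unique ζ
  ζ! = freshList-unique (suc B) (length θ)
  ζ-length : length ζ ≡ length θ
  ζ-length = freshList-length (suc B) (length θ)
  ζ#B : Fresh ζ B
  ζ#B x x≤B = freshList-fresh (s≤s x≤B)
  ζ#p : Fresh ζ (bnd p)
  ζ#p = Fresh-≤ ζ#B (≤-trans (bnd-lamᵖ θ p s) (m≤m⊔n (bnd (lam θ p s)) (bnd (lam θ′ p′ s′))))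
  ζ#s : Fresh ζ (bnd s)
  ζ#s = Fresh-≤ ζ#B (≤-trans (bnd-lamˢ θ p s) (m≤m⊔n (bnd (lam θ p s)) (bnd (lam θ′ p′ s′))))
  ζ#p′ : Fresh ζ (bnd p′)
  ζ#p′ = Fresh-≤ ζ#B (≤-trans (bnd-lamᵖ θ′ p′ s′) (m≤n⊔m (bnd (lam θ p s)) (bnd (lam θ′ p′ s′))))
  ζ#s′ : Fresh ζ (bnd s′)
  ζ#s′ = Fresh-≤ ζ#B (≤-trans (bnd-lamˢ θ′ p′ s′) (m≤n⊔m (bnd (lam θ p s)) (bnd (lam θ′ p′ s′))))
  size-p : size (substR [] (zip θ ζ) p) ≤ n
  size-p = ≤-trans (≤-reflexive (size-substR p [] _ λ ())) (≤-trans (m≤m+n (size p) (size s)) ps≤n)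
  size-s : size (substR (zip θ (map var ζ)) [] s) ≤ n
  size-s = ≤-trans (≤-reflexive (size-substR s _ [] (AllValues-renaming-[] {IsVar} θ ζ λ y → y , refl)))
                   (≤-trans (m≤n+m (size s) (size p)) ps≤n)
toDB-injective-≤ (suc n) (var x) (mat y) _ ρv-atoms ρm-atoms _ _ h =
  ⊥-elim (IsDv∧IsDm⇒⊥ (subst IsDv h (isDv ρv-atoms x)) (isDm ρm-atoms y))
toDB-injective-≤ (suc n) (var x) (app _ _) _ ρv-atoms _ _ _ h = ⊥-elim (subst IsDv h (isDv ρv-atoms x))
toDB-injective-≤ (suc n) (var x) (lam _ _ _) _ ρv-atoms _ _ _ h = ⊥-elim (subst IsDv h (isDv ρv-atoms x))
toDB-injective-≤ (suc n) (mat x) (var y) _ ρv-atoms ρm-atoms _ _ h =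
  ⊥-elim (IsDv∧IsDm⇒⊥ (subst IsDv (sym h) (isDv ρv-atoms y)) (isDm ρm-atoms x))
toDB-injective-≤ (suc n) (mat x) (app _ _) _ _ ρm-atoms _ _ h = ⊥-elim (subst IsDm h (isDm ρm-atoms x))
toDB-injective-≤ (suc n) (mat x) (lam _ _ _) _ _ ρm-atoms _ _ h = ⊥-elim (subst IsDm h (isDm ρm-atoms x))
toDB-injective-≤ (suc n) (app _ _) (var y) _ ρv-atoms _ _ _ h = ⊥-elim (subst IsDv (sym h) (isDv ρv-atoms y))
toDB-injective-≤ (suc n) (app _ _) (mat y) _ _ ρm-atoms _ _ h = ⊥-elim (subst IsDm (sym h) (isDm ρm-atoms y))
toDB-injective-≤ (suc n) (lam _ _ _) (var y) _ ρv-atoms _ _ _ h = ⊥-elim (subst IsDv (sym h) (isDv ρv-atoms y))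
toDB-injective-≤ (suc n) (lam _ _ _) (mat y) _ _ ρm-atoms _ _ h = ⊥-elim (subst IsDm (sym h) (isDm ρm-atoms y))
toDB-injective-≤ (suc n) (app _ _) (lam _ _ _) _ _ _ _ _ ()
toDB-injective-≤ (suc n) (lam _ _ _) (app _ _) _ _ _ _ _ ()

toDB-injective : ∀ {ρv ρm} a b → VarAtoms ρv → MatAtoms ρm →
  UniqueBinders a → UniqueBinders b → toDB ρv ρm a ≡ toDB ρv ρm b → a ≈α b
toDB-injective a b = toDB-injective-≤ (size a) a b ≤-refl

freshBinders : List (List Sym) → List (List Sym) → ℕ → List Sym
freshBinders V M n = freshList (suc (maxSyms V M)) n

data UGraph (V M : List (List Sym)) : DTerm → Term → Set where
  var : ∀ {i j x} → lookup2 V i j ≡ just x → UGraph V M (dv i j) (var x)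
  mat : ∀ {i j x} → lookup2 M i j ≡ just x → UGraph V M (dm i j) (mat x)
  app : ∀ {t u a b} → UGraph V M t a → UGraph V M u b → UGraph V M (dapp t u) (app a b)
  lam : ∀ {n p s a b} → UGraph V (freshBinders V M n ∷ M) p a → UGraph (freshBinders V M n ∷ V) M s b →
        UGraph V M (dlam n p s) (lam (freshBinders V M n) a b)

U⇒UGraph : ∀ V M t {w} → U V M t ≡ just w → UGraph V M t w
U⇒UGraph V M (dv i j) eq with lookup2 V i j in eqV
U⇒UGraph V M (dv i j) refl | just x = var eqV
U⇒UGraph V M (dm i j) eq with lookup2 M i j in eqM
U⇒UGraph V M (dm i j) refl | just x = mat eqM
U⇒UGraph V M (dapp t u) eq with U V M t in eqt | U V M u in equ
U⇒UGraph V M (dapp t u) refl | just a | just b = app (U⇒UGraph V M t eqt) (U⇒UGraph V M u equ)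
U⇒UGraph V M (dlam n p s) eq with U V (freshBinders V M n ∷ M) p in eqp | U (freshBinders V M n ∷ V) M s in eqs
U⇒UGraph V M (dlam n p s) refl | just a | just b = lam (U⇒UGraph V _ p eqp) (U⇒UGraph _ M s eqs)

UGraph⇒U : ∀ {V M t w} → UGraph V M t w → U V M t ≡ just w
UGraph⇒U (var eq) rewrite eq = refl
UGraph⇒U (mat eq) rewrite eq = refl
UGraph⇒U (app gt gu) rewrite UGraph⇒U gt | UGraph⇒U gu = refl
UGraph⇒U (lam gp gs) rewrite UGraph⇒U gp | UGraph⇒U gs = refl

CanonicalV : Env → List (List Sym) → Set
CanonicalV ρ V = ∀ {i j x} → lookup2 V i j ≡ just x → ρ x ≡ dv i j

CanonicalM : Env → List (List Sym) → Set
CanonicalM ρ M = ∀ {i j x} → lookup2 M i j ≡ just x → ρ x ≡ dm i j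

extendV-canonical : ∀ {ρ V θ} → Unique θ → (∀ {x} → x ∈ concat V → x ∉ θ) → CanonicalV ρ V →
                    CanonicalV (extendV θ ρ) (θ ∷ V)
extendV-canonical {θ = θ} θ! V#θ ρ-can {suc zero} {zero} eq with () ← proj₁ (nth-bounds θ eq)
extendV-canonical θ! V#θ ρ-can {suc zero} {suc j} eq rewrite indexOf-nth θ! eq = refl
extendV-canonical {V = V} θ! V#θ ρ-can {suc (suc i)} eq rewrite indexOf-∉ (V#θ (lookup2-∈ V eq)) | ρ-can eq = refl

extendM-canonical : ∀ {ρ M θ} → Unique θ → (∀ {x} → x ∈ concat M → x ∉ θ) → CanonicalM ρ M →
                    CanonicalM (extendM θ ρ) (θ ∷ M)
extendM-canonical {θ = θ} θ! M#θ ρ-can {suc zero} {zero} eq with () ← proj₁ (nth-bounds θ eq)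
extendM-canonical θ! M#θ ρ-can {suc zero} {suc j} eq rewrite indexOf-nth θ! eq = refl
extendM-canonical {M = M} θ! M#θ ρ-can {suc (suc i)} eq rewrite indexOf-∉ (M#θ (lookup2-∈ M eq)) | ρ-can eq = refl

freshBinders-canonicalV : ∀ {ρ} V M n → CanonicalV ρ V → CanonicalV (extendV (freshBinders V M n) ρ) (freshBinders V M n ∷ V)
freshBinders-canonicalV V M n =
  extendV-canonical (freshList-unique _ n) λ x∈V → freshList-fresh (s≤s (∈-maxL (∈-++⁺ˡ x∈V)))

freshBinders-canonicalM : ∀ {ρ} V M n → CanonicalM ρ M → CanonicalM (extendM (freshBinders V M n) ρ) (freshBinders V M n ∷ M)
freshBinders-canonicalM V M n =
  extendM-canonical (freshList-unique _ n) λ x∈M → freshList-fresh (s≤s (∈-maxL (∈-++⁺ʳ (concat V) x∈M)))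

UGraph-toDB : ∀ {V M t w ρv ρm} → CanonicalV ρv V → CanonicalM ρm M → UGraph V M t w → toDB ρv ρm w ≡ t
UGraph-toDB ρv-can ρm-can (var eq) = ρv-can eq
UGraph-toDB ρv-can ρm-can (mat eq) = ρm-can eq
UGraph-toDB ρv-can ρm-can (app gt gu) = cong₂ dapp (UGraph-toDB ρv-can ρm-can gt) (UGraph-toDB ρv-can ρm-can gu)
UGraph-toDB {V} {M} ρv-can ρm-can (lam {n} gp gs) = dlam-cong (freshList-length _ n)
  (UGraph-toDB (cong (upM 0) ∘ ρv-can) (freshBinders-canonicalM V M n ρm-can) gp)
  (UGraph-toDB (freshBinders-canonicalV V M n ρv-can) (cong (upV 0) ∘ ρm-can) gs)

UGraph-UniqueBinders : ∀ {V M t w} → UGraph V M t w → UniqueBinders w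
UGraph-UniqueBinders (var _) = tt
UGraph-UniqueBinders (mat _) = tt
UGraph-UniqueBinders (app gt gu) = UGraph-UniqueBinders gt , UGraph-UniqueBinders gu
UGraph-UniqueBinders (lam gp gs) = freshList-unique _ _ , UGraph-UniqueBinders gp , UGraph-UniqueBinders gs

Unique-++⁻ : ∀ (xs : List Sym) {ys} → Unique (xs ++ ys) → Unique xs × Unique ys × (∀ {y} → y ∈ ys → y ∉ xs)
Unique-++⁻ [] ys! = [] , ys! , λ _ ()
Unique-++⁻ (x ∷ xs) (x∉ ∷ xsys!) with Unique-++⁻ xs xsys!
... | xs! , ys! , ys#xs = ++⁻ˡ xs x∉ ∷ xs! , ys! ,
  λ { y∈ys (here refl) → All.lookup x∉ (∈-++⁺ʳ xs y∈ys) refl ; y∈ys (there y∈xs) → ys#xs y∈ys y∈xs }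

-- Symbols outside V go to the unused level 0, which keeps envV V injective.
envV : List (List Sym) → Env
envV [] x = dv 0 x
envV (θ ∷ V) = extendV θ (envV V)

envM : List (List Sym) → Env
envM [] x = dm 0 x
envM (θ ∷ M) = extendM θ (envM M)

envV-VarAtoms : ∀ V → VarAtoms (envV V)
envV-VarAtoms [] = record { isDv = λ _ → tt ; injective = proj₂ ∘ dv-injective }
envV-VarAtoms (θ ∷ V) = extendV-VarAtoms θ (envV-VarAtoms V)

envM-MatAtoms : ∀ M → MatAtoms (envM M)
envM-MatAtoms [] = record { isDm = λ _ → tt ; injective = proj₂ ∘ dm-injective }
envM-MatAtoms (θ ∷ M) = extendM-MatAtoms θ (envM-MatAtoms M)

envV-canonical : ∀ V → Unique (concat V) → CanonicalV (envV V) V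
envV-canonical [] _ ()
envV-canonical (θ ∷ V) θV! with Unique-++⁻ θ θV!
... | θ! , V! , V#θ = extendV-canonical θ! V#θ (envV-canonical V V!)

envM-canonical : ∀ M → Unique (concat M) → CanonicalM (envM M) M
envM-canonical [] _ ()
envM-canonical (θ ∷ M) θM! with Unique-++⁻ θ θM!
... | θ! , M! , M#θ = extendM-canonical θ! M#θ (envM-canonical M M!)

lookupL-mapσ : ∀ f σ j → lookupL (mapσ f σ) j ≡ mapMaybe f (lookupL σ j)
lookupL-mapσ f [] j = refl
lookupL-mapσ f ((j′ , u) ∷ σ) j with j ≡ᵇ j′
... | true  = refl
... | false = lookupL-mapσ f σ j

lookupL-mapσ-just : ∀ f σ {j u} → lookupL σ j ≡ just u → lookupL (mapσ f σ) j ≡ just (f u)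
lookupL-mapσ-just f σ {j} eq = trans (lookupL-mapσ f σ j) (cong (mapMaybe f) eq)

lookupL-mapσ-just⁻ : ∀ f σ {j u′} → lookupL (mapσ f σ) j ≡ just u′ → ∃[ u ] lookupL σ j ≡ just u × u′ ≡ f u
lookupL-mapσ-just⁻ f σ {j} eq with lookupL σ j in eqσ | trans (sym (lookupL-mapσ f σ j)) eq
... | just u | refl = u , refl , refl

substD-dv-≢ : ∀ {l i} σ j → i ≢ l → substD l σ (dv i j) ≡ dv i j
substD-dv-≢ {l} {i} σ j i≢l with i ≡ᵇ l | ≡ᵇ-reflects i l | lookupL σ j
... | true  | ofʸ i≡l | _       = ⊥-elim (i≢l i≡l)
... | false | _       | just _  = refl
... | false | _       | nothing = refl

substD-dv-just : ∀ {l} σ {j u} → lookupL σ j ≡ just u → substD l σ (dv l j) ≡ u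
substD-dv-just {l} σ eq rewrite det (≡ᵇ-reflects l l) (ofʸ refl) | eq = refl

substD-dv-nothing : ∀ {l i} σ {j} → lookupL σ j ≡ nothing → substD l σ (dv i j) ≡ dv i j
substD-dv-nothing {l} {i} σ eq rewrite eq with i ≡ᵇ l
... | true  = refl
... | false = refl

substD-dv-mapσ : ∀ {l} f σ i j → f (dv i j) ≡ dv i j → substD l (mapσ f σ) (dv i j) ≡ f (substD l σ (dv i j))
substD-dv-mapσ {l} f σ i j f-dv with i ≟ l
... | no i≢l = trans (substD-dv-≢ (mapσ f σ) j i≢l) (sym (trans (cong f (substD-dv-≢ σ j i≢l)) f-dv))
... | yes refl = by-lookup (lookupL σ j) refl
  where
  by-lookup : ∀ m → lookupL σ j ≡ m → substD i (mapσ f σ) (dv i j) ≡ f (substD i σ (dv i j))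
  by-lookup (just u) eq = trans (substD-dv-just {i} (mapσ f σ) (lookupL-mapσ-just f σ eq)) (cong f (sym (substD-dv-just {i} σ eq)))
  by-lookup nothing eq = trans (substD-dv-nothing (mapσ f σ) (trans (lookupL-mapσ f σ j) (cong (mapMaybe f) eq)))
                               (sym (trans (cong f (substD-dv-nothing σ eq)) f-dv))

shiftIdx0-unshiftIdx : ∀ {i k} → i ≢ k → shiftIdx 0 (unshiftIdx k (suc i)) ≡ unshiftIdx (suc k) (suc (suc i))
shiftIdx0-unshiftIdx {i} {k} i≢k with ≤-<-connex (suc i) k
... | inj₁ 1+i≤k rewrite unshiftIdx-≤ 1+i≤k | unshiftIdx-≤ (s≤s 1+i≤k) = refl
... | inj₂ k<1+i rewrite unshiftIdx-> k<1+i | unshiftIdx-> (s≤s k<1+i) =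
  shiftIdx-> (≤-trans (s≤s z≤n) (≤∧≢⇒< (≤-pred k<1+i) (i≢k ∘ sym)))

SubstCanonical : Env → List (List Sym) → ℕ → List (ℕ × DTerm) → Set
SubstCanonical ρ V k σ = ∀ i j {x} → lookup2 V i j ≡ just x → ρ x ≡ downV k (substD (suc k) σ (dv i j))

ShiftedValues : ℕ → List (ℕ × DTerm) → Set
ShiftedValues k σ = ∀ {j u} → lookupL σ j ≡ just u → ∃[ X ] u ≡ upV k X

Covers : List (ℕ × DTerm) → List (List Sym) → ℕ → Set
Covers σ V k = ∀ {j x} → lookup2 V (suc k) j ≡ just x → ∃[ u ] lookupL σ j ≡ just u

Covers-mapσ : ∀ f {σ V k} → Covers σ V k → Covers (mapσ f σ) V k
Covers-mapσ f {σ} cov eq with cov eq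
... | u , eqσ = f u , lookupL-mapσ-just f σ eqσ

ShiftedValues-upM : ∀ {k σ} → ShiftedValues k σ → ShiftedValues k (mapσ (upM 0) σ)
ShiftedValues-upM {k} {σ} sh eq with lookupL-mapσ-just⁻ (upM 0) σ eq
... | u , eqσ , refl with sh eqσ
...   | X , refl = upM 0 X , upM-upV 0 k X

ShiftedValues-upV : ∀ {k σ} → ShiftedValues k σ → ShiftedValues (suc k) (mapσ (upV 0) σ)
ShiftedValues-upV {k} {σ} sh eq with lookupL-mapσ-just⁻ (upV 0) σ eq
... | u , eqσ , refl with sh eqσ
...   | X , refl = upV 0 X , sym (upV-upV X z≤n)

SubstCanonical-upM : ∀ {ρ V k σ} → SubstCanonical ρ V k σ → SubstCanonical (upM 0 ∘ ρ) V k (mapσ (upM 0) σ)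
SubstCanonical-upM {ρ} {V} {k} {σ} ρ-can i j {x} eq = begin
  upM 0 (ρ x)                                         ≡⟨ cong (upM 0) (ρ-can i j eq) ⟩
  upM 0 (downV k (substD (suc k) σ (dv i j)))          ≡⟨ upM-downV 0 k (substD (suc k) σ (dv i j)) ⟩
  downV k (upM 0 (substD (suc k) σ (dv i j)))          ≡⟨ cong (downV k) (sym (substD-dv-mapσ (upM 0) σ i j refl)) ⟩
  downV k (substD (suc k) (mapσ (upM 0) σ) (dv i j))   ∎
  where open ≡-Reasoning

SubstCanonical-extendV : ∀ {ρ V k σ θ} → Unique θ → (∀ {x} → x ∈ concat V → x ∉ θ) → ShiftedValues k σ → Covers σ V k →
  SubstCanonical ρ V k σ → SubstCanonical (extendV θ ρ) (θ ∷ V) (suc k) (mapσ (upV 0) σ)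
SubstCanonical-extendV {θ = θ} θ! V#θ sh cov ρ-can (suc zero) zero eq with () ← proj₁ (nth-bounds θ eq)
SubstCanonical-extendV θ! V#θ sh cov ρ-can (suc zero) (suc j) eq rewrite indexOf-nth θ! eq = refl
SubstCanonical-extendV {ρ} {V} {k} {σ} θ! V#θ sh cov ρ-can (suc (suc i)) j {x} eq
  rewrite indexOf-∉ (V#θ (lookup2-∈ V eq)) | ρ-can (suc i) j eq with i ≟ k
... | no i≢k rewrite substD-dv-≢ σ j (i≢k ∘ suc-injective)
                   | substD-dv-≢ (mapσ (upV 0) σ) j (i≢k ∘ suc-injective ∘ suc-injective)
                   | downV-dv k (suc i) j | upV-dv 0 (unshiftIdx k (suc i)) j | downV-dv (suc k) (suc (suc i)) j
  = cong (λ i → dv i j) (shiftIdx0-unshiftIdx i≢k)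
... | yes refl with cov eq
...   | u , eqσ with sh eqσ
...     | X , refl = begin
  upV 0 (downV i (substD (suc i) σ (dv (suc i) j)))                  ≡⟨ cong (upV 0 ∘ downV i) (substD-dv-just {suc i} σ eqσ) ⟩
  upV 0 (downV i (upV i X))                                         ≡⟨ cong (upV 0) (downV-upV i X) ⟩
  upV 0 X                                                           ≡⟨ sym (downV-upV (suc i) (upV 0 X)) ⟩
  downV (suc i) (upV (suc i) (upV 0 X))                              ≡⟨ cong (downV (suc i)) (upV-upV X z≤n) ⟩
  downV (suc i) (upV 0 (upV i X))
    ≡⟨ cong (downV (suc i)) (sym (substD-dv-just {suc (suc i)} (mapσ (upV 0) σ) (lookupL-mapσ-just (upV 0) σ eqσ))) ⟩
  downV (suc i) (substD (suc (suc i)) (mapσ (upV 0) σ) (dv (suc (suc i)) j)) ∎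
  where open ≡-Reasoning

UGraph-toDB-substD : ∀ {V M t w k σ ρv ρm} → SubstCanonical ρv V k σ → CanonicalM ρm M → ShiftedValues k σ → Covers σ V k →
                     UGraph V M t w → toDB ρv ρm w ≡ downV k (substD (suc k) σ t)
UGraph-toDB-substD ρv-can ρm-can sh cov (var {i} {j} eq) = ρv-can i j eq
UGraph-toDB-substD ρv-can ρm-can sh cov (mat eq) = ρm-can eq
UGraph-toDB-substD ρv-can ρm-can sh cov (app gt gu) =
  cong₂ dapp (UGraph-toDB-substD ρv-can ρm-can sh cov gt) (UGraph-toDB-substD ρv-can ρm-can sh cov gu)
UGraph-toDB-substD {V} {M} {k = k} {σ} ρv-can ρm-can sh cov (lam {n} gp gs) = dlam-cong (freshList-length _ n)
  (UGraph-toDB-substD (SubstCanonical-upM {V = V} {k} {σ} ρv-can) (freshBinders-canonicalM V M n ρm-can)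
                      (ShiftedValues-upM {k} {σ} sh) (Covers-mapσ (upM 0) {σ} {V} cov) gp)
  (UGraph-toDB-substD (SubstCanonical-extendV {V = V} {k} {σ} {freshBinders V M n} (freshList-unique _ n) θ#V sh cov ρv-can)
                      (cong (upV 0) ∘ ρm-can) (ShiftedValues-upV {k} {σ} sh) (Covers-mapσ (upV 0) {σ} {V} cov) gs)
  where
  θ#V : ∀ {x} → x ∈ concat V → x ∉ freshBinders V M n
  θ#V x∈V = freshList-fresh (s≤s (∈-maxL (∈-++⁺ˡ x∈V)))

-- Matching

isMFD-upV : ∀ k t → isMFD (upV k t) ≡ isMFD t
isMFD-upV k (dv i j) rewrite upV-dv k i j = refl
isMFD-upV k (dm i j) = refl
isMFD-upV k (dapp a b) = isDataD-upV a
  where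
  isDataD-upV : ∀ t → isDataD (upV k t) ≡ isDataD t
  isDataD-upV (dv i j) rewrite upV-dv k i j = refl
  isDataD-upV (dm i j) = refl
  isDataD-upV (dapp a b) = isDataD-upV a
  isDataD-upV (dlam n p s) = refl
isMFD-upV k (dlam n p s) = refl

UGraph-isData : ∀ {V M t w} → UGraph V M t w → isData w ≡ isDataD t
UGraph-isData (var _) = refl
UGraph-isData (mat _) = refl
UGraph-isData (app gt _) = UGraph-isData gt
UGraph-isData (lam _ _) = refl

UGraph-isMF : ∀ {V M t w} → UGraph V M t w → isMF w ≡ isMFD t
UGraph-isMF (var _) = refl
UGraph-isMF (mat _) = refl
UGraph-isMF (app gt _) = UGraph-isData gt
UGraph-isMF (lam _ _) = refl

module Matching (V M : List (List Sym)) (n : ℕ)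
  (M-positions : ∀ {i j c d x} → lookup2 M i j ≡ just x → lookup2 M c d ≡ just x → i ≡ c × j ≡ d) where

  θ : List Sym
  θ = freshBinders V M n

  base : ℕ
  base = suc (maxSyms V M)

  -- θ lists base , base + 1 , …, and a dB value carries the shift applied to the argument in the β-rule.
  data Entry : ℕ × DTerm → Sym × Term → Set where
    entry : ∀ i {w₀ w′} → UGraph V M w₀ w′ → Entry (suc i , upV 0 w₀) (base + i , w′)

  data MatchRel : Match (List (ℕ × DTerm)) → Match (List (Sym × Term)) → Set where
    ok   : ∀ {σ σN} → Pointwise Entry σ σN → MatchRel (ok σ) (ok σN)
    fail : MatchRel fail fail
    wait : MatchRel wait wait

  if-MatchRel : ∀ {b b′ m₁ m₂ m₁′ m₂′} → b ≡ b′ → MatchRel m₁ m₁′ → MatchRel m₂ m₂′ →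
                MatchRel (if b then m₁ else m₂) (if b′ then m₁′ else m₂′)
  if-MatchRel {true} refl r₁ r₂ = r₁
  if-MatchRel {false} refl r₁ r₂ = r₂

  keys : ∀ {σ σN} → Pointwise Entry σ σN → ∃[ is ] map proj₁ σ ≡ map suc is × map proj₁ σN ≡ map (base +_) is
  keys [] = [] , refl , refl
  keys (entry i _ ∷ rel) with keys rel
  ... | is , eq , eqN = i ∷ is , cong (suc i ∷_) eq , cong (base + i ∷_) eqN

  union-MatchRel : ∀ {m₁ m₂ m₁′ m₂′} → MatchRel m₁ m₁′ → MatchRel m₂ m₂′ → MatchRel (unionM m₁ m₂) (unionM m₁′ m₂′)
  union-MatchRel {ok σ₁} {ok σ₂} {ok σN₁} {ok σN₂} (ok rel₁) (ok rel₂) with keys rel₁ | keys rel₂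
  ... | is₁ , eq₁ , eqN₁ | is₂ , eq₂ , eqN₂ = if-MatchRel disjoint-keys (ok (++⁺ rel₁ rel₂)) fail
    where
    disjoint-keys : disjoint (map proj₁ σ₁) (map proj₁ σ₂) ≡ disjoint (map proj₁ σN₁) (map proj₁ σN₂)
    disjoint-keys = begin
      disjoint (map proj₁ σ₁) (map proj₁ σ₂)    ≡⟨ cong₂ disjoint eq₁ eq₂ ⟩
      disjoint (map suc is₁) (map suc is₂)      ≡⟨ disjoint-map suc-injective is₁ is₂ ⟩
      disjoint is₁ is₂                          ≡⟨ sym (disjoint-map (+-cancelˡ-≡ base _ _) is₁ is₂) ⟩
      disjoint (map (base +_) is₁) (map (base +_) is₂) ≡⟨ sym (cong₂ disjoint eqN₁ eqN₂) ⟩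
      disjoint (map proj₁ σN₁) (map proj₁ σN₂)  ∎
      where open ≡-Reasoning
  union-MatchRel (ok _) fail = fail
  union-MatchRel (ok _) wait = wait
  union-MatchRel fail _ = fail
  union-MatchRel wait fail = fail
  union-MatchRel wait (ok _) = wait
  union-MatchRel wait wait = wait

  rest-MatchRel : ∀ p u′ P U → shiftedMat p u′ ≡ sameMatN P U → isMFD p ≡ isMF P → isMFD u′ ≡ isMF U →
                  MatchRel (restD p u′) (restN P U)
  rest-MatchRel _ _ _ _ sm p-mf u-mf = if-MatchRel sm (ok []) (if-MatchRel (cong₂ _∧_ p-mf u-mf) fail wait)

  positions-≡ᵇ : ∀ {i j c d x y} → lookup2 M i j ≡ just x → lookup2 M c d ≡ just y → ((i ≡ᵇ c) ∧ (j ≡ᵇ d)) ≡ (x ≡ᵇ y)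
  positions-≡ᵇ {i} {j} {c} {d} {x} {y} ex ey with i ≡ᵇ c | ≡ᵇ-reflects i c | j ≡ᵇ d | ≡ᵇ-reflects j d
  ... | true  | ofʸ refl | true  | ofʸ refl = sym (det (≡ᵇ-reflects x y) (ofʸ (just-injective (trans (sym ex) ey))))
  ... | true  | ofʸ refl | false | ofⁿ j≢d = sym (det (≡ᵇ-reflects x y) (ofⁿ λ { refl → j≢d (proj₂ (M-positions ex ey)) }))
  ... | false | ofⁿ i≢c | _     | _        = sym (det (≡ᵇ-reflects x y) (ofⁿ λ { refl → i≢c (proj₁ (M-positions ex ey)) }))

  isMFD-upV-UGraph : ∀ {u U} → UGraph V M u U → isMFD (upV 0 u) ≡ isMF U
  isMFD-upV-UGraph {u} gu = trans (isMFD-upV 0 u) (sym (UGraph-isMF gu))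

  matchD-MatchRel : ∀ {p u P U} → UGraph V (θ ∷ M) p P → UGraph V M u U → MatchRel (matchD p (upV 0 u)) (matchN θ P U)
  matchD-MatchRel (var _) gu = wait
  matchD-MatchRel (mat {suc zero} eq) gu with nth-freshList base n eq
  ... | i , refl , refl rewrite ∈⇒∈ᵇ (nth-∈ θ eq) = ok (entry i gu ∷ [])
  matchD-MatchRel {u = u} {U = U} (mat {suc (suc i)} {j} {x} eq) gu
    rewrite ∉⇒∈ᵇ (freshList-fresh {k = base} {n} (s≤s (lookup2-≤-maxSymsʳ V M eq))) =
    rest-MatchRel (dm (suc (suc i)) j) (upV 0 u) (mat x) U (shifted≡same gu) refl (isMFD-upV-UGraph gu)
    where
    shifted≡same : ∀ {u U} → UGraph V M u U → shiftedMat (dm (suc (suc i)) j) (upV 0 u) ≡ sameMatN (mat x) U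
    shifted≡same (var {a} {b} _) rewrite upV-dv 0 a b = refl
    shifted≡same (mat ey) = positions-≡ᵇ eq ey
    shifted≡same (app _ _) = refl
    shifted≡same (lam _ _) = refl
  matchD-MatchRel {dapp p₁ p₂} {P = app P₁ P₂} gp@(app gp₁ gp₂) gu = by-argument gu
    where
    p-mf : isMFD (dapp p₁ p₂) ≡ isMF (app P₁ P₂)
    p-mf = sym (UGraph-isMF gp)
    rest : ∀ {u U} → UGraph V M u U → MatchRel (restD (dapp p₁ p₂) (upV 0 u)) (restN (app P₁ P₂) U)
    rest {u} {U} gu = rest-MatchRel (dapp p₁ p₂) (upV 0 u) (app P₁ P₂) U refl p-mf (isMFD-upV-UGraph gu)
    by-argument : ∀ {u U} → UGraph V M u U → MatchRel (matchD (dapp p₁ p₂) (upV 0 u)) (matchN θ (app P₁ P₂) U)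
    by-argument gu@(app gu₁ gu₂) = if-MatchRel (cong₂ _∧_ p-mf (isMFD-upV-UGraph gu))
      (union-MatchRel (matchD-MatchRel gp₁ gu₁) (matchD-MatchRel gp₂ gu₂)) (rest gu)
    -- matchD only reduces once upV 0 (dv a b) has been rewritten to an atom.
    by-argument gu@(var {a} {b} _) with rest gu
    ... | r rewrite upV-dv 0 a b = r
    by-argument gu@(mat _) = rest gu
    by-argument gu@(lam _ _) = rest gu
  matchD-MatchRel {dlam m p₁ p₂} {u} {P} {U} (lam _ _) gu = rest-MatchRel (dlam m p₁ p₂) (upV 0 u) P U refl refl (isMFD-upV-UGraph gu)

  matchDB-MatchRel : ∀ {p u P U} → UGraph V (θ ∷ M) p P → UGraph V M u U → MatchRel (matchDB n p (upV 0 u)) (matchPPC θ P U)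
  matchDB-MatchRel {p} {u} {P} {U} gp gu with matchD p (upV 0 u) | matchN θ P U | matchD-MatchRel gp gu
  ... | ok σ | ok σN | ok rel = if-MatchRel (same-domain rel) (ok rel) fail
    where
    same-domain : Pointwise Entry σ σN → sameSet (map proj₁ σ) (map suc (upTo n)) ≡ sameSet (map proj₁ σN) θ
    same-domain rel with keys rel
    ... | is , eq , eqN rewrite eq | eqN =
      trans (sameSet-map suc-injective is (upTo n)) (sym (sameSet-map (+-cancelˡ-≡ base _ _) is (upTo n)))
  ... | fail | fail | fail = fail
  ... | wait | wait | wait = wait

  lookupL-Entry : ∀ {σ σN} → Pointwise Entry σ σN → ∀ i′ {w} → lookupL σ (suc i′) ≡ just w →
                  ∃[ w′ ] lookupL σN (base + i′) ≡ just w′ × ∃[ w₀ ] w ≡ upV 0 w₀ × UGraph V M w₀ w′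
  lookupL-Entry (entry i g ∷ rel) i′ eq rewrite ≡ᵇ-map (+-cancelˡ-≡ base _ _) i′ i with i′ ≡ᵇ i | eq
  ... | true  | refl = _ , refl , _ , refl , g
  ... | false | eq′  = lookupL-Entry rel i′ eq′

  lookupL-Entry-≤ : ∀ {σ σN} → Pointwise Entry σ σN → ∀ {x} → x ≤ maxSyms V M → lookupL σN x ≡ nothing
  lookupL-Entry-≤ [] x≤ = refl
  lookupL-Entry-≤ (entry i g ∷ rel) {x} x≤
    rewrite det (≡ᵇ-reflects x (base + i)) (ofⁿ λ { refl → <⇒≱ (s≤s x≤) (m≤m+n base i) }) = lookupL-Entry-≤ rel x≤

  lookupL-Entry-value : ∀ {σ σN} → Pointwise Entry σ σN → ∀ {j w} → lookupL σ j ≡ just w →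
                        ∃₂ λ w₀ w′ → w ≡ upV 0 w₀ × UGraph V M w₀ w′
  lookupL-Entry-value (entry i g ∷ rel) {j} eq with j ≡ᵇ suc i | eq
  ... | true  | refl = _ , _ , refl , g
  ... | false | eq′  = lookupL-Entry-value rel eq′

  Entry-UniqueBinders : ∀ {σ σN} → Pointwise Entry σ σN → AllValues UniqueBinders σN
  Entry-UniqueBinders (entry i g ∷ rel) {x} eq with x ≡ᵇ base + i | eq
  ... | true  | refl = UGraph-UniqueBinders g
  ... | false | eq′  = Entry-UniqueBinders rel eq′

  MatchRel-ok : ∀ {σ m′} → MatchRel (ok σ) m′ → ∃[ σN ] m′ ≡ ok σN × Pointwise Entry σ σN
  MatchRel-ok (ok rel) = _ , refl , rel

  MatchRel-fail : ∀ {m′} → MatchRel fail m′ → m′ ≡ fail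
  MatchRel-fail fail = refl

  matchDB-ok : ∀ {p u P U σ} → UGraph V (θ ∷ M) p P → UGraph V M u U → matchDB n p (upV 0 u) ≡ ok σ →
               ∃[ σN ] matchPPC θ P U ≡ ok σN × Pointwise Entry σ σN
  matchDB-ok {P = P} {U} gp gu eq = MatchRel-ok (subst (λ m → MatchRel m (matchPPC θ P U)) eq (matchDB-MatchRel gp gu))

  matchDB-fail : ∀ {p u P U} → UGraph V (θ ∷ M) p P → UGraph V M u U →
                 matchDB n p (upV 0 u) ≡ fail → matchPPC θ P U ≡ fail
  matchDB-fail {P = P} {U} gp gu eq = MatchRel-fail (subst (λ m → MatchRel m (matchPPC θ P U)) eq (matchDB-MatchRel gp gu))

matchDB-domain : ∀ n p u {σ} → matchDB n p u ≡ ok σ → sameSet (map proj₁ σ) (map suc (upTo n)) ≡ true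
matchDB-domain n p u eq with matchD p u
... | ok σ′ with sameSet (map proj₁ σ′) (map suc (upTo n)) in eqS | eq
...   | true | refl = eqS

matchDB-covers : ∀ n p u {σ j} → matchDB n p u ≡ ok σ → 1 ≤ j → j ≤ n → ∃[ w ] lookupL σ j ≡ just w
matchDB-covers n p u {σ} {suc i} eq _ i<n =
  lookupL-∈ σ (∈ᵇ⇒∈ (all-∈ (λ y → y ∈ᵇ map proj₁ σ) (∧≡true⇒ʳ (matchDB-domain n p u eq)) (∈-map⁺ suc (∈-upTo⁺ i<n))))

-- Well-scopedness

InScope : List ℕ → ℕ → ℕ → Set
InScope ns i j = ∃[ m ] nth ns i ≡ just m × 1 ≤ j × j ≤ m

WellScoped : List ℕ → List ℕ → DTerm → Set
WellScoped ns ms (dv i j) = InScope ns i j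
WellScoped ns ms (dm i j) = InScope ms i j
WellScoped ns ms (dapp a b) = WellScoped ns ms a × WellScoped ns ms b
WellScoped ns ms (dlam n p s) = WellScoped ns (n ∷ ms) p × WellScoped (n ∷ ns) ms s

widths : List (List Sym) → List ℕ
widths = map length

InScope-cong : ∀ {ns ns′ i i′ j} → nth ns′ i′ ≡ nth ns i → InScope ns i j → InScope ns′ i′ j
InScope-cong eq (m , eqm , bounds) = m , trans eq eqm , bounds

lookup2-InScope : ∀ V {i j x} → lookup2 V i j ≡ just x → InScope (widths V) i j
lookup2-InScope V {i} eq with nth V i in eqV
... | just row = length row , trans (nth-map length V i) (cong (mapMaybe length) eqV) , nth-bounds row eq

InScope-lookup2 : ∀ V {i j} → InScope (widths V) i j → ∃[ x ] lookup2 V i j ≡ just x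
InScope-lookup2 V {i} (m , eqm , 1≤j , j≤m) with nth V i in eqV | trans (sym (nth-map length V i)) eqm
... | just row | refl = nth-defined row 1≤j j≤m

UGraph-WellScoped : ∀ {V M t w} → UGraph V M t w → WellScoped (widths V) (widths M) t
UGraph-WellScoped {V} (var eq) = lookup2-InScope V eq
UGraph-WellScoped {M = M} (mat eq) = lookup2-InScope M eq
UGraph-WellScoped (app gt gu) = UGraph-WellScoped gt , UGraph-WellScoped gu
UGraph-WellScoped {V} {M} (lam {n} {p} {s} gp gs) =
  subst (λ m → WellScoped (widths V) (m ∷ widths M) p) (freshList-length _ n) (UGraph-WellScoped gp) ,
  subst (λ m → WellScoped (m ∷ widths V) (widths M) s) (freshList-length _ n) (UGraph-WellScoped gs)

WellScoped-UGraph : ∀ V M t → WellScoped (widths V) (widths M) t → ∃[ w ] UGraph V M t w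
WellScoped-UGraph V M (dv i j) sc = _ , var (proj₂ (InScope-lookup2 V sc))
WellScoped-UGraph V M (dm i j) sc = _ , mat (proj₂ (InScope-lookup2 M sc))
WellScoped-UGraph V M (dapp t u) (sc-t , sc-u) = _ , app (proj₂ (WellScoped-UGraph V M t sc-t)) (proj₂ (WellScoped-UGraph V M u sc-u))
WellScoped-UGraph V M (dlam n p s) (sc-p , sc-s) = _ ,
  lam (proj₂ (WellScoped-UGraph V _ p (subst (λ m → WellScoped (widths V) (m ∷ widths M) p) (sym (freshList-length _ n)) sc-p)))
      (proj₂ (WellScoped-UGraph _ M s (subst (λ m → WellScoped (m ∷ widths V) (widths M) s) (sym (freshList-length _ n)) sc-s)))

insertScope : ℕ → ℕ → List ℕ → List ℕ
insertScope zero m ns = m ∷ ns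
insertScope (suc c) m [] = []
insertScope (suc c) m (m′ ∷ ns) = m′ ∷ insertScope c m ns

removeScope : ℕ → List ℕ → List ℕ
removeScope k [] = []
removeScope zero (m ∷ ns) = ns
removeScope (suc k) (m ∷ ns) = m ∷ removeScope k ns

nth-zero : ∀ {A : Set} (xs : List A) → nth xs 0 ≡ nothing
nth-zero [] = refl
nth-zero (x ∷ xs) = refl

nth-insertScope-≤ : ∀ c m ns {i} → i ≤ c → nth (insertScope c m ns) i ≡ nth ns i
nth-insertScope-≤ c m ns {zero} _ = trans (nth-zero (insertScope c m ns)) (sym (nth-zero ns))
nth-insertScope-≤ (suc c) m [] {suc i} _ = refl
nth-insertScope-≤ (suc c) m (m′ ∷ ns) {suc zero} _ = refl
nth-insertScope-≤ (suc c) m (m′ ∷ ns) {suc (suc i)} (s≤s i<c) = nth-insertScope-≤ c m ns i<c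

nth-insertScope-> : ∀ c m ns {i} → c < i → nth (insertScope c m ns) (suc i) ≡ nth ns i
nth-insertScope-> zero m ns {suc i} _ = refl
nth-insertScope-> (suc c) m [] {suc i} _ = refl
nth-insertScope-> (suc c) m (m′ ∷ ns) {suc (suc i)} (s≤s c<i) = nth-insertScope-> c m ns c<i

nth-insertScope : ∀ c m ns i → nth (insertScope c m ns) (shiftIdx c i) ≡ nth ns i
nth-insertScope c m ns i with ≤-<-connex i c
... | inj₁ i≤c rewrite shiftIdx-≤ i≤c = nth-insertScope-≤ c m ns i≤c
... | inj₂ c<i rewrite shiftIdx-> c<i = nth-insertScope-> c m ns c<i

nth-removeScope-≤ : ∀ k ns {i} → i ≤ k → nth (removeScope k ns) i ≡ nth ns i
nth-removeScope-≤ k ns {zero} _ = trans (nth-zero (removeScope k ns)) (sym (nth-zero ns))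
nth-removeScope-≤ (suc k) [] {suc i} _ = refl
nth-removeScope-≤ (suc k) (m ∷ ns) {suc zero} _ = refl
nth-removeScope-≤ (suc k) (m ∷ ns) {suc (suc i)} (s≤s i<k) = nth-removeScope-≤ k ns i<k

nth-removeScope-> : ∀ k ns {i} → k < i → nth (removeScope k ns) i ≡ nth ns (suc i)
nth-removeScope-> zero [] {suc i} _ = refl
nth-removeScope-> zero (m ∷ ns) {suc i} _ = refl
nth-removeScope-> (suc k) [] {suc i} _ = refl
nth-removeScope-> (suc k) (m ∷ ns) {suc (suc i)} (s≤s k<i) = nth-removeScope-> k ns k<i

nth-removeScope : ∀ k ns i → i ≢ suc k → nth (removeScope k ns) (unshiftIdx k i) ≡ nth ns i
nth-removeScope k ns i i≢1+k with ≤-<-connex i k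
... | inj₁ i≤k rewrite unshiftIdx-≤ i≤k = nth-removeScope-≤ k ns i≤k
... | inj₂ k<i with i
...   | suc i′ rewrite unshiftIdx-> k<i = nth-removeScope-> k ns (≤∧≢⇒< (≤-pred k<i) (i≢1+k ∘ cong suc ∘ sym))

WellScoped-upV : ∀ c m {ns ms} X → WellScoped ns ms X → WellScoped (insertScope c m ns) ms (upV c X)
WellScoped-upV c m {ns} (dv i j) sc rewrite upV-dv c i j = InScope-cong {ns} {insertScope c m ns} {i} (nth-insertScope c m ns i) sc
WellScoped-upV c m (dm i j) sc = sc
WellScoped-upV c m (dapp a b) (sc-a , sc-b) = WellScoped-upV c m a sc-a , WellScoped-upV c m b sc-b
WellScoped-upV c m (dlam n p s) (sc-p , sc-s) = WellScoped-upV c m p sc-p , WellScoped-upV (suc c) m s sc-s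

WellScoped-upM : ∀ c m {ns ms} X → WellScoped ns ms X → WellScoped ns (insertScope c m ms) (upM c X)
WellScoped-upM c m (dv i j) sc = sc
WellScoped-upM c m {ms = ms} (dm i j) sc rewrite upM-dm c i j = InScope-cong {ms} {insertScope c m ms} {i} (nth-insertScope c m ms i) sc
WellScoped-upM c m (dapp a b) (sc-a , sc-b) = WellScoped-upM c m a sc-a , WellScoped-upM c m b sc-b
WellScoped-upM c m (dlam n p s) (sc-p , sc-s) = WellScoped-upM (suc c) m p sc-p , WellScoped-upM c m s sc-s

ScopedValues : ℕ → List (ℕ × DTerm) → List ℕ → List ℕ → Set
ScopedValues k σ ns ms = ∀ {j w} → lookupL σ j ≡ just w → ∃[ X ] w ≡ upV k X × WellScoped (removeScope k ns) ms X

CoversScope : List (ℕ × DTerm) → List ℕ → ℕ → Set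
CoversScope σ ns k = ∀ {j} → InScope ns (suc k) j → ∃[ w ] lookupL σ j ≡ just w

WellScoped-substD : ∀ t k σ {ns ms} → CoversScope σ ns k → ScopedValues k σ ns ms →
                    WellScoped ns ms t → WellScoped (removeScope k ns) ms (downV k (substD (suc k) σ t))
WellScoped-substD (dv i j) k σ {ns} cov vals sc with i ≟ suc k
... | yes refl with cov sc
...   | w , eq with vals eq
...     | X , refl , sc-X rewrite substD-dv-just {suc k} σ eq | downV-upV k X = sc-X
WellScoped-substD (dv i j) k σ {ns} cov vals sc | no i≢1+k
  rewrite substD-dv-≢ σ j i≢1+k | downV-dv k i j = InScope-cong {ns} {removeScope k ns} {i} (nth-removeScope k ns i i≢1+k) sc
WellScoped-substD (dm i j) k σ cov vals sc = sc
WellScoped-substD (dapp a b) k σ cov vals (sc-a , sc-b) =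
  WellScoped-substD a k σ cov vals sc-a , WellScoped-substD b k σ cov vals sc-b
WellScoped-substD (dlam m p s) k σ {ns} {ms} cov vals (sc-p , sc-s) =
  WellScoped-substD p k (mapσ (upM 0) σ) (Covers-up (upM 0) {ns} cov) vals-p sc-p ,
  WellScoped-substD s (suc k) (mapσ (upV 0) σ) (Covers-up (upV 0) {ns} cov) vals-s sc-s
  where
  Covers-up : ∀ f {ns′} → CoversScope σ ns′ k → CoversScope (mapσ f σ) ns′ k
  Covers-up f cov′ sc′ with cov′ sc′
  ... | w , eq = f w , lookupL-mapσ-just f σ eq
  vals-p : ScopedValues k (mapσ (upM 0) σ) ns (m ∷ ms)
  vals-p eq with lookupL-mapσ-just⁻ (upM 0) σ eq
  ... | w , eqσ , refl with vals eqσ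
  ...   | X , refl , sc-X = upM 0 X , upM-upV 0 k X , WellScoped-upM 0 m X sc-X
  vals-s : ScopedValues (suc k) (mapσ (upV 0) σ) (m ∷ ns) ms
  vals-s eq with lookupL-mapσ-just⁻ (upV 0) σ eq
  ... | w , eqσ , refl with vals eqσ
  ...   | X , refl , sc-X = upV 0 X , sym (upV-upV X z≤n) , WellScoped-upV 0 m X sc-X

-- Simulation

record Simulation (V M : List (List Sym)) (ρv ρm : Env) (w : Term) (t′ : DTerm) : Set where
  constructor simulation
  field
    reduct        : Term
    reduces       : w ⟶ reduct
    reduct-unique : UniqueBinders reduct
    target        : Term
    target-graph  : UGraph V M t′ target
    reduct-toDB   : toDB ρv ρm reduct ≡ t′

CanonicalM⇒positions : ∀ {ρ M} → CanonicalM ρ M →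
                       ∀ {i j c d x} → lookup2 M i j ≡ just x → lookup2 M c d ≡ just x → i ≡ c × j ≡ d
CanonicalM⇒positions ρ-can ex ey = dm-injective (trans (sym (ρ-can ex)) (ρ-can ey))

simulate-β-ok : ∀ {V M ρv ρm n p s u P S U σ} → CanonicalV ρv V → CanonicalM ρm M →
  UGraph V (freshBinders V M n ∷ M) p P → UGraph (freshBinders V M n ∷ V) M s S → UGraph V M u U →
  matchDB n p (upV 0 u) ≡ ok σ → Simulation V M ρv ρm (app (lam (freshBinders V M n) P S) U) (downV 0 (substD 1 σ s))
simulate-β-ok {V} {M} {ρv} {ρm} {n} {p} {s} {u} {S = S} {σ = σ} ρv-can ρm-can gp gs gu eq
  with Matching.matchDB-ok V M n (CanonicalM⇒positions {M = M} ρm-can) gp gu eq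
... | σN , eqN , rel = simulation (substR σN [] S) (β-ok eqN) (UniqueBinders-substR S σN [] (Entry-UniqueBinders rel))
  _ (proj₂ (WellScoped-UGraph V M _ (WellScoped-substD s 0 σ covers-scope scoped-values s-scoped)))
  (trans (toDB-substR S σN [] (λ _ _ → refl) (λ _ _ → refl))
         (UGraph-toDB-substD substCanonical ρm-can shifted covers gs))
  where
  open Matching V M n (CanonicalM⇒positions {M = M} ρm-can)
  θ-length : length θ ≡ n
  θ-length = freshList-length base n
  covers : Covers σ (θ ∷ V) 0
  covers eqθ with nth-bounds θ eqθ
  ... | 1≤j , j≤θ = matchDB-covers n p (upV 0 u) eq 1≤j (subst (_ ≤_) θ-length j≤θ)
  covers-scope : CoversScope σ (n ∷ widths V) 0
  covers-scope (m , refl , 1≤j , j≤n) = matchDB-covers n p (upV 0 u) eq 1≤j j≤n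
  shifted : ShiftedValues 0 σ
  shifted eqσ with lookupL-Entry-value rel eqσ
  ... | w₀ , _ , refl , _ = w₀ , refl
  scoped-values : ScopedValues 0 σ (n ∷ widths V) (widths M)
  scoped-values eqσ with lookupL-Entry-value rel eqσ
  ... | w₀ , _ , refl , g = w₀ , refl , UGraph-WellScoped g
  s-scoped : WellScoped (n ∷ widths V) (widths M) s
  s-scoped = subst (λ m → WellScoped (m ∷ widths V) (widths M) s) θ-length (UGraph-WellScoped gs)
  substCanonical : SubstCanonical (substEnvV σN ρv ρm) (θ ∷ V) 0 σ
  substCanonical (suc zero) j eqθ with nth-freshList base n eqθ | covers eqθ
  ... | i , refl , refl | w , eqσ with lookupL-Entry rel i eqσ
  ...   | w′ , eqσN , w₀ , refl , g rewrite eqσN | substD-dv-just {1} σ eqσ | downV-upV 0 w₀ = UGraph-toDB ρv-can ρm-can g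
  substCanonical (suc (suc i)) j eqV rewrite lookupL-Entry-≤ rel (lookup2-≤-maxSymsˡ V M eqV) = ρv-can eqV

simulate-β-fail : ∀ {V M ρv ρm n p u P S U} → CanonicalM ρm M →
  UGraph V (freshBinders V M n ∷ M) p P → UGraph V M u U → matchDB n p (upV 0 u) ≡ fail →
  Simulation V M ρv ρm (app (lam (freshBinders V M n) P S) U) (downV 0 (dlam 1 (dm 1 1) (dv 1 1)))
simulate-β-fail {V} {M} {n = n} ρm-can gp gu eq =
  simulation _ (β-fail (matchDB-fail gp gu eq)) ([] ∷ [] , tt , tt) _ (U⇒UGraph V M _ refl) refl
  where open Matching V M n (CanonicalM⇒positions {M = M} ρm-can)

simulate : ∀ {t t′ V M ρv ρm w} → t ⟶dB t′ → CanonicalV ρv V → CanonicalM ρm M → UGraph V M t w →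
           Simulation V M ρv ρm w t′
simulate (β-ok eq) ρv-can ρm-can (app (lam gp gs) gu) = simulate-β-ok ρv-can ρm-can gp gs gu eq
simulate (β-fail eq) ρv-can ρm-can (app (lam gp gs) gu) = simulate-β-fail ρm-can gp gu eq
simulate (appL st) ρv-can ρm-can (app gt gu) with simulate st ρv-can ρm-can gt
... | simulation r r← r! _ g′ r↦ =
  simulation (app r _) (appL r←) (r! , UGraph-UniqueBinders gu) _ (app g′ gu) (cong₂ dapp r↦ (UGraph-toDB ρv-can ρm-can gu))
simulate (appR st) ρv-can ρm-can (app gt gu) with simulate st ρv-can ρm-can gu
... | simulation r r← r! _ g′ r↦ =
  simulation (app _ r) (appR r←) (UGraph-UniqueBinders gt , r!) _ (app gt g′) (cong₂ dapp (UGraph-toDB ρv-can ρm-can gt) r↦)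
simulate {V = V} {M} (lamP st) ρv-can ρm-can (lam {n} gp gs)
  with simulate st (cong (upM 0) ∘ ρv-can) (freshBinders-canonicalM V M n ρm-can) gp
... | simulation r r← r! _ g′ r↦ =
  simulation (lam _ r _) (lamP r←) (freshList-unique _ n , r! , UGraph-UniqueBinders gs) _ (lam g′ gs)
    (dlam-cong (freshList-length _ n) r↦ (UGraph-toDB (freshBinders-canonicalV V M n ρv-can) (cong (upV 0) ∘ ρm-can) gs))
simulate {V = V} {M} (lamS st) ρv-can ρm-can (lam {n} gp gs)
  with simulate st (freshBinders-canonicalV V M n ρv-can) (cong (upV 0) ∘ ρm-can) gs
... | simulation r r← r! _ g′ r↦ =
  simulation (lam _ _ r) (lamS r←) (freshList-unique _ n , UGraph-UniqueBinders gp , r!) _ (lam gp g′)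
    (dlam-cong (freshList-length _ n) (UGraph-toDB (cong (upM 0) ∘ ρv-can) (freshBinders-canonicalM V M n ρm-can) gp) r↦)

lemma5p4 : (t t' : DTerm) (V M : List (List Sym)) (u : Term) →
    Unique (concat V) → Unique (concat M) →
    U V M t ≡ just u → t ⟶dB t' →
    ∃[ u' ] (U V M t' ≡ just u' × u →PPC u')
lemma5p4 t t' V M u V! M! U≡u st with simulate st (envV-canonical V V!) (envM-canonical M M!) (U⇒UGraph V M t U≡u)
... | simulation r u⟶r r! u′ g′ r↦t′ =
  u′ , UGraph⇒U g′ , u , r , ≈α-refl u , u⟶r ,
  toDB-injective r u′ (envV-VarAtoms V) (envM-MatAtoms M) r! (UGraph-UniqueBinders g′)
    (trans r↦t′ (sym (UGraph-toDB (envV-canonical V V!) (envM-canonical M M!) g′)))
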